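{- Almost all $k \times k$ permutation matrices $P$ are ordinary.
   Context: A permutation matrix $Q$ reduces to Class $i$ if some sequence of vertical/horizontal reflections and $90$ degree rotations takes $Q$ to an element of Class $i$, and $Q$ is ordinary if it reduces to none of Classes 1–4 below. In all classes, row sets $R_1, R_2, R_3$ are nonempty sets of contiguous rows in that top-to-bottom order, and column sets $C_1, C_2, C_3$ are nonempty sets of contiguous columns in that left-to-right order. Class 1: permutation matrices $P$ whose rows split into $R_1, R_2$ and columns into $C_1, C_2$ such that $P$ has ones in $R_1 \times C_1$ and in $R_2 \times C_2$, and has ones only in those submatrices except for at most $2$ ones in $R_1 \times C_2$; if there are two ones in $R_1 \times C_2$, they are in adjacent rows. Class 2: permutation matrices $P$ whose rows split into $R_1, R_2, R_3$ and columns into $C_1, C_2$ such that $P$ has ones in $R_1 \times C_2$ and in $R_3 \times C_2$, at least two ones in $R_2 \times C_1$, and ones only in those submatrices except for at most $2$ ones in $R_2 \times C_2$; if there are two ones in $R_2 \times C_2$, they are in adjacent rows. Class 3: permutation matrices obtained from an element $X$ of Class 2 by taking the row $r$ of $X$ containing the rightmost one in the submatrix $R_2 \times C_1$, deleting $r$ from its position, and inserting it above the first row of $X$. Class 4: permutation matrices $P$ whose rows split into $R_1, R_2, R_3$ and columns into $C_1, C_2, C_3$ such that $P$ has ones in $R_1 \times C_2$, $R_2 \times C_1$, $R_2 \times C_3$ and $R_3 \times C_2$, and only in those submatrices. "Almost all" means the number of non-ordinary $k \times k$ permutation matrices is $o(k!)$ as $k \to \infty$. -}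

module Defs where

open import Data.Nat using (ℕ; zero; suc; _≤_; _<_)
open import Data.Fin using (Fin; toℕ)
open import Data.Bool using (Bool; true)
open import Data.Vec using (Vec; _∷_; lookup; reverse; transpose; removeAt; map)
open import Data.Product using (Σ; ∃; _×_; _,_)
open import Data.Sum using (_⊎_)
open import Relation.Nullary using (¬_)
open import Relation.Binary.PropositionalEquality using (_≡_; _≢_)

-- A k×k 0/1 matrix: a vector of k rows, each a vector of k entries (true = 1).
Matrix : ℕ → Set
Matrix k = Vec (Vec Bool k) k

One : ∀ {k} → Matrix k → Fin k → Fin k → Set
One M i j = lookup (lookup M i) j ≡ true

IsPermMatrix : ∀ {k} → Matrix k → Set
IsPermMatrix {k} M =
  (∀ i → ∃ λ j → One M i j × (∀ j' → One M i j' → j' ≡ j)) ×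
  (∀ j → ∃ λ i → One M i j × (∀ i' → One M i' j → i' ≡ i))

In : ∀ {k} → ℕ → ℕ → Fin k → Set
In lo hi i = lo ≤ toℕ i × toℕ i < hi

HasOne : ∀ {k} → Matrix k → ℕ → ℕ → ℕ → ℕ → Set
HasOne M r0 r1 c0 c1 = ∃ λ i → ∃ λ j → In r0 r1 i × In c0 c1 j × One M i j

-- the block contains at most 2 ones, and if it contains two they are in
-- adjacent rows: all its ones lie in rows r and r+1 for some r
-- (for a permutation matrix each row has only one 1)
AtMostTwoAdj : ∀ {k} → Matrix k → ℕ → ℕ → ℕ → ℕ → Set
AtMostTwoAdj M r0 r1 c0 c1 = ∃ λ r → ∀ i j → In r0 r1 i → In c0 c1 j → One M i j →
  (toℕ i ≡ r) ⊎ (toℕ i ≡ suc r)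

-- Class 1 with row cut a (R1=[0,a), R2=[a,k)) and column cut c (C1=[0,c), C2=[c,k)).
Class1 : ∀ {k} → Matrix k → Set
Class1 {k} M = ∃ λ a → ∃ λ c → 0 < a × a < k × 0 < c × c < k ×
  HasOne M 0 a 0 c × HasOne M a k c k ×
  (∀ i j → One M i j → (In 0 a i × In 0 c j) ⊎ (In a k i × In c k j) ⊎ (In 0 a i × In c k j)) ×
  AtMostTwoAdj M 0 a c k

-- Class 2 with explicit cuts: R1=[0,a), R2=[a,b), R3=[b,k), C1=[0,c), C2=[c,k).
Class2At : ∀ {k} → Matrix k → ℕ → ℕ → ℕ → Set
Class2At {k} M a b c = 0 < a × a < b × b < k × 0 < c × c < k ×
  HasOne M 0 a c k × HasOne M b k c k ×
  (∃ λ i → ∃ λ j → ∃ λ i' → ∃ λ j' → In a b i × In 0 c j × One M i j ×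
     In a b i' × In 0 c j' × One M i' j' × i ≢ i') ×
  (∀ i j → One M i j → (In 0 a i × In c k j) ⊎ (In b k i × In c k j) ⊎
     (In a b i × In 0 c j) ⊎ (In a b i × In c k j)) ×
  AtMostTwoAdj M a b c k

Class2 : ∀ {k} → Matrix k → Set
Class2 M = ∃ λ a → ∃ λ b → ∃ λ c → Class2At M a b c

moveRowToTop : ∀ {k} → Matrix k → Fin k → Matrix k
moveRowToTop {suc n} M r = lookup M r ∷ removeAt M r

-- Class 3: from X in Class 2 (with its decomposition), move the row r containing
-- the rightmost one of R2 × C1 to the top.
Class3 : ∀ {k} → Matrix k → Set
Class3 {k} P = ∃ λ (X : Matrix k) → ∃ λ a → ∃ λ b → ∃ λ c → Class2At X a b c ×
  ∃ λ (r : Fin k) → ∃ λ (j : Fin k) → In a b r × In 0 c j × One X r j ×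
  (∀ i' j' → In a b i' → In 0 c j' → One X i' j' → toℕ j' ≤ toℕ j) ×
  P ≡ moveRowToTop X r

-- Class 4: R1=[0,a), R2=[a,b), R3=[b,k), C1=[0,c), C2=[c,d), C3=[d,k).
Class4 : ∀ {k} → Matrix k → Set
Class4 {k} M = ∃ λ a → ∃ λ b → ∃ λ c → ∃ λ d →
  0 < a × a < b × b < k × 0 < c × c < d × d < k ×
  HasOne M 0 a c d × HasOne M a b 0 c × HasOne M a b d k × HasOne M b k c d ×
  (∀ i j → One M i j → (In 0 a i × In c d j) ⊎ (In a b i × In 0 c j) ⊎
     (In a b i × In d k j) ⊎ (In b k i × In c d j))

vReflect : ∀ {k} → Matrix k → Matrix k
vReflect = map reverse

hReflect : ∀ {k} → Matrix k → Matrix k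
hReflect = reverse

rotate90 : ∀ {k} → Matrix k → Matrix k   -- clockwise rotation by 90 degrees
rotate90 M = map reverse (transpose M)

data Reaches {k : ℕ} : Matrix k → Matrix k → Set where
  done  : ∀ {M} → Reaches M M
  stepV : ∀ {M N} → Reaches (vReflect M) N → Reaches M N
  stepH : ∀ {M N} → Reaches (hReflect M) N → Reaches M N
  stepR : ∀ {M N} → Reaches (rotate90 M) N → Reaches M N

ReducesTo : ∀ {k} → (Matrix k → Set) → Matrix k → Set
ReducesTo C Q = ∃ λ Q' → Reaches Q Q' × C Q'

NonOrdinary : ∀ {k} → Matrix k → Set
NonOrdinary Q = ReducesTo Class1 Q ⊎ ReducesTo Class2 Q ⊎ ReducesTo Class3 Q ⊎ ReducesTo Class4 Q

Ordinary : ∀ {k} → Matrix k → Set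
Ordinary Q = ¬ NonOrdinary Q

-- Up to the eight symmetries of the square, a non-ordinary permutation matrix maps a set of
-- columns B, missing at most v columns, into a set A of at most u rows, and there are at most
-- u! v! such matrices: the rows of the columns in B form an injective word into A, followed by an
-- injective word for the remaining columns. Each class provides such a pair (A, B) from a list of
-- O(k³) candidates with u + v ≤ k + 2 and u, v ≤ k − 1. Since x! (N − x)! is largest for extreme
-- x, the candidates weigh at most 564 (k − 1)! in total, so at most 8 · 564 · (k − 1)! = o(k!)
-- permutation matrices are not ordinary.

module Submission where

open import Defs
open import Data.Nat using (ℕ; zero; suc; pred; _+_; _*_; _∸_; _⊓_; _≤_; _<_; z≤n; s≤s; _!; _≤ᵇ_; _<ᵇ_; _≤?_; _<?_; _≟_)
open import Data.Nat.Properties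
open import Data.List using (List; []; _∷_; _++_; length; take; map; concatMap; filter; allFin; cartesianProduct)
open import Data.List.Properties using (length-map; length-++; length-tabulate; take-map; ∷-injective; map-cong; map-++; map-∘)
open import Data.Nat.ListAction using (sum)
open import Data.Nat.ListAction.Properties using (sum-++)
open import Data.Bool using (Bool; true; false; not; if_then_else_; _∧_; _∨_)
open import Data.Bool.Properties using (not-injective; not-involutive; T-≡; T-∧)
import Data.Bool as Bool
open import Data.Unit using (⊤; tt)
open import Data.Empty using (⊥)
open import Data.Fin using (Fin; zero; suc; toℕ; opposite; punchIn; punchOut; fromℕ; inject₁; fromℕ<)
import Data.Fin as Fin
open import Data.Vec using (Vec; []; _∷_; lookup; reverse; transpose; replicate; _⊛_; _∷ʳ_; removeAt)
import Data.Vec as Vec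
open import Data.Vec.Properties using (tabulate∘lookup; tabulate-cong; reverse-∷; lookup-⊛; lookup-replicate; lookup-map; removeAt-punchOut)
open import Data.Fin.Properties using (opposite-involutive; toℕ-injective; toℕ-fromℕ<; toℕ<n; punchOut-punchIn; punchIn-punchOut; punchInᵢ≢i)
open import Data.List.Relation.Unary.All as All using (All; []; _∷_)
open import Data.List.Relation.Unary.All.Properties using (take⁺; all-filter) renaming (map⁺ to All-map⁺)
open import Data.List.Relation.Unary.Any using (Any; here; there)
import Data.List.Relation.Unary.Any.Properties as Any
open import Data.List.Relation.Unary.Unique.Propositional using (Unique)
open import Data.List.Relation.Unary.Unique.Propositional.Properties using (map⁺; filter⁺; allFin⁺; ++⁺)
open import Data.List.Membership.Propositional using (_∈_; find; lose)
open import Data.List.Membership.Propositional.Properties using (∈-filter⁺; ∈-allFin; ∈-++⁺ˡ; ∈-++⁺ʳ; ∈-cartesianProduct⁺)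
open import Data.List.Relation.Unary.AllPairs using ([]; _∷_)
open import Data.Product using (∃; ∃₂; _×_; _,_; proj₁; proj₂)
open import Data.Sum using (_⊎_; inj₁; inj₂)
open import Function using (_∘_; Equivalence)
open import Level using (0ℓ)
open import Relation.Binary.Definitions using (DecidableEquality)
open import Relation.Binary.PropositionalEquality
open import Relation.Nullary using (yes; no; contradiction)
open import Relation.Unary using (Pred; _∪_; _∩_; U)
open import Algebra.Properties.CommutativeSemigroup *-commutativeSemigroup using (x∙yz≈y∙xz)

private variable
  A B : Set
  m n : ℕ

!-mono : m ≤ n → m ! ≤ n !
!-mono {zero} {n} _ = 1≤n! n
!-mono {suc m} {suc n} (s≤s m≤n) = *-mono-≤ (s≤s m≤n) (!-mono m≤n)

fallingFactorial : ℕ → ℕ → ℕ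
fallingFactorial n zero = 1
fallingFactorial n (suc k) = n * fallingFactorial (n ∸ 1) k

fallingFactorial≤! : ∀ n k → fallingFactorial n k ≤ n !
fallingFactorial≤! n zero = 1≤n! n
fallingFactorial≤! zero (suc k) = z≤n
fallingFactorial≤! (suc n) (suc k) = *-monoʳ-≤ (suc n) (fallingFactorial≤! n k)

-- x ! * y ! grows as x and y move apart with x + y fixed
factorial-shift : ∀ d a y → a + d ≤ y → (a + d) ! * y ! ≤ a ! * (d + y) !
factorial-shift zero a y _ = ≤-reflexive (cong (λ x → x ! * y !) (+-identityʳ a))
factorial-shift (suc d) a y a+d<y = begin
  (a + suc d) ! * y !              ≡⟨ cong (λ x → x ! * y !) (+-suc a d) ⟩
  suc (a + d) * (a + d) ! * y !    ≡⟨ *-assoc (suc (a + d)) ((a + d) !) (y !) ⟩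
  suc (a + d) * ((a + d) ! * y !)  ≡⟨ x∙yz≈y∙xz (suc (a + d)) ((a + d) !) (y !) ⟩
  (a + d) ! * (suc (a + d) * y !)  ≤⟨ *-monoʳ-≤ ((a + d) !) (*-monoˡ-≤ (y !) (m≤n⇒m≤1+n a+d<y')) ⟩
  (a + d) ! * (suc y) !            ≤⟨ factorial-shift d a (suc y) (≤-trans (n≤1+n (a + d)) (m≤n⇒m≤1+n a+d<y')) ⟩
  a ! * (d + suc y) !              ≡⟨ cong (λ x → a ! * x !) (+-suc d y) ⟩
  a ! * (suc d + y) !              ∎
  where
  open ≤-Reasoning
  a+d<y' : suc (a + d) ≤ y
  a+d<y' = subst (_≤ y) (+-suc a d) a+d<y

factorial-product-≤-ordered : ∀ a N x y → x + y ≤ N → x ≤ y → y ≤ N ∸ a → x ! * y ! ≤ a ! * (N ∸ a) !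
factorial-product-≤-ordered a N x y x+y≤N x≤y y≤ with a ≤? x
... | no a≰x = *-mono-≤ (!-mono (<⇒≤ (≰⇒> a≰x))) (!-mono y≤)
... | yes a≤x with m≤n⇒∃[o]m+o≡n a≤x
...   | d , refl = ≤-trans (factorial-shift d a y x≤y)
  (*-monoʳ-≤ (a !) (!-mono (m+n≤o⇒m≤o∸n (d + y) (subst (_≤ N) (trans (+-assoc a d y) (+-comm a (d + y))) x+y≤N))))

factorial-product-≤ : ∀ a N x y → x + y ≤ N → x ≤ N ∸ a → y ≤ N ∸ a → x ! * y ! ≤ a ! * (N ∸ a) !
factorial-product-≤ a N x y x+y≤N x≤ y≤ with x ≤? y
... | yes x≤y = factorial-product-≤-ordered a N x y x+y≤N x≤y y≤
... | no x≰y = subst (_≤ a ! * (N ∸ a) !) (*-comm (y !) (x !))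
  (factorial-product-≤-ordered a N y x (subst (_≤ N) (+-comm x y) x+y≤N) (<⇒≤ (≰⇒> x≰y)) x≤)

sum-of-multiples : ∀ a b c x → a * x + (b * x + c * x) ≡ (a + (b + c)) * x
sum-of-multiples a b c x = trans (cong (a * x +_) (sym (*-distribʳ-+ x b c))) (sym (*-distribʳ-+ x a (b + c)))

take-length-++ : (xs ys : List A) → take (length xs) (xs ++ ys) ≡ xs
take-length-++ [] ys = refl
take-length-++ (x ∷ xs) ys = cong (x ∷_) (take-length-++ xs ys)

map-≡-∈ : {f g : A → B} {xs : List A} → map f xs ≡ map g xs → ∀ {x} → x ∈ xs → f x ≡ g x
map-≡-∈ {xs = _ ∷ _} e (here refl) = proj₁ (∷-injective e)
map-≡-∈ {xs = _ ∷ _} e (there x∈) = map-≡-∈ (proj₂ (∷-injective e)) x∈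

sum-map-≤ : (f : A → ℕ) (xs : List A) {b : ℕ} → (∀ {x} → x ∈ xs → f x ≤ b) → sum (map f xs) ≤ length xs * b
sum-map-≤ f [] _ = z≤n
sum-map-≤ f (x ∷ xs) f≤b = +-mono-≤ (f≤b (here refl)) (sum-map-≤ f xs (f≤b ∘ there))

sum-map-++ : (f : A → ℕ) (xs ys : List A) → sum (map f (xs ++ ys)) ≡ sum (map f xs) + sum (map f ys)
sum-map-++ f xs ys = trans (cong sum (map-++ f xs ys)) (sum-++ (map f xs) (map f ys))

sum-map-concatMap : (w : B → ℕ) (f : A → List B) (xs : List A) →
  sum (map w (concatMap f xs)) ≡ sum (map (λ x → sum (map w (f x))) xs)
sum-map-concatMap w f [] = refl
sum-map-concatMap w f (x ∷ xs) = trans (sum-map-++ w (f x) (concatMap f xs)) (cong (sum (map w (f x)) +_) (sum-map-concatMap w f xs))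

sum-map-map : (w : B → ℕ) (f : A → B) (xs : List A) → sum (map w (map f xs)) ≡ sum (map (w ∘ f) xs)
sum-map-map w f xs = cong sum (sym (map-∘ xs))

range : ℕ → ℕ → List ℕ
range lo zero = []
range lo (suc n) = lo ∷ range (suc lo) n

∈-range : ∀ {lo n x} → lo ≤ x → x < lo + n → x ∈ range lo n
∈-range {lo} {zero} lo≤x x<lo+0 = contradiction (subst (_ <_) (+-identityʳ lo) x<lo+0) (≤⇒≯ lo≤x)
∈-range {lo} {suc n} {x} lo≤x x<lo+n with lo ≟ x
... | yes refl = here refl
... | no lo≢x = there (∈-range (≤∧≢⇒< lo≤x lo≢x) (subst (x <_) (+-suc lo n) x<lo+n))

∈-range⁻ : ∀ {lo n x} → x ∈ range lo n → lo ≤ x × x < lo + n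
∈-range⁻ {lo} {suc n} (here refl) = ≤-refl , m<m+n lo (s≤s z≤n)
∈-range⁻ {lo} {suc n} {x} (there x∈) with ∈-range⁻ x∈
... | lo<x , x<lo+n = <⇒≤ lo<x , subst (x <_) (sym (+-suc lo n)) x<lo+n

length-range : ∀ lo n → length (range lo n) ≡ n
length-range lo zero = refl
length-range lo (suc n) = cong suc (length-range (suc lo) n)

range-++ : ∀ lo p q → range lo (p + q) ≡ range lo p ++ range (lo + p) q
range-++ lo zero q = cong (λ x → range x q) (sym (+-identityʳ lo))
range-++ lo (suc p) q = cong (lo ∷_) (trans (range-++ (suc lo) p q) (cong (λ x → range (suc lo) p ++ range x q) (sym (+-suc lo p))))

sum-range-≤ : ∀ (f : ℕ → ℕ) lo n {b} → (∀ x → lo ≤ x → x < lo + n → f x ≤ b) → sum (map f (range lo n)) ≤ n * b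
sum-range-≤ f lo n {b} f≤b = subst (λ m → sum (map f (range lo n)) ≤ m * b) (length-range lo n)
  (sum-map-≤ f (range lo n) λ x∈ → let (lo≤x , x<) = ∈-range⁻ x∈ in f≤b _ lo≤x x<)

sum-range-split₃ : ∀ (f : ℕ → ℕ) lo p q r {b₁ b₂ b₃} →
  (∀ x → lo ≤ x → x < lo + p → f x ≤ b₁) →
  (∀ x → lo + p ≤ x → x < lo + p + q → f x ≤ b₂) →
  (∀ x → lo + p + q ≤ x → x < lo + p + q + r → f x ≤ b₃) →
  sum (map f (range lo (p + (q + r)))) ≤ p * b₁ + (q * b₂ + r * b₃)
sum-range-split₃ f lo p q r f≤b₁ f≤b₂ f≤b₃ = begin
  sum (map f (range lo (p + (q + r))))
    ≡⟨ cong (sum ∘ map f) (range-++ lo p (q + r)) ⟩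
  sum (map f (range lo p ++ range (lo + p) (q + r)))
    ≡⟨ sum-map-++ f (range lo p) _ ⟩
  sum (map f (range lo p)) + sum (map f (range (lo + p) (q + r)))
    ≡⟨ cong (λ xs → sum (map f (range lo p)) + sum (map f xs)) (range-++ (lo + p) q r) ⟩
  sum (map f (range lo p)) + sum (map f (range (lo + p) q ++ range (lo + p + q) r))
    ≡⟨ cong (sum (map f (range lo p)) +_) (sum-map-++ f (range (lo + p) q) _) ⟩
  sum (map f (range lo p)) + (sum (map f (range (lo + p) q)) + sum (map f (range (lo + p + q) r)))
    ≤⟨ +-mono-≤ (sum-range-≤ f lo p f≤b₁) (+-mono-≤ (sum-range-≤ f (lo + p) q f≤b₂) (sum-range-≤ f (lo + p + q) r f≤b₃)) ⟩
  p * _ + (q * _ + r * _) ∎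
  where open ≤-Reasoning

between : ℕ → ℕ → List ℕ
between lo hi = range lo (hi ∸ lo)

∈-between : ∀ {lo hi x} → lo ≤ x → x < hi → x ∈ between lo hi
∈-between lo≤x x<hi = ∈-range lo≤x (subst (_ <_) (sym (m+[n∸m]≡n (≤-trans lo≤x (<⇒≤ x<hi)))) x<hi)

lose-concatMap-map : ∀ {I J : Set} {P : Pred A 0ℓ} {f : I → J → A} {g : I → List J} {xs : List I} {x y} →
  x ∈ xs → y ∈ g x → P (f x y) → Any P (concatMap (λ x → map (f x) (g x)) xs)
lose-concatMap-map {f = f} {g} x∈ y∈ p = Any.concatMap⁺ (λ x → map (f x) (g x)) (lose x∈ (Any.map⁺ (lose y∈ p)))

Bool-ext : {a b : Bool} → (a ≡ true → b ≡ true) → (b ≡ true → a ≡ true) → a ≡ b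
Bool-ext {true} a⇒b _ = sym (a⇒b refl)
Bool-ext {false} {true} _ b⇒a = b⇒a refl
Bool-ext {false} {false} _ _ = refl

∨-≡-true : ∀ {x y} → x ≡ true ⊎ y ≡ true → (x ∨ y) ≡ true
∨-≡-true (inj₁ refl) = refl
∨-≡-true {true} (inj₂ _) = refl
∨-≡-true {false} (inj₂ y≡true) = y≡true

∨-≡-true⁻ : ∀ {x y} → (x ∨ y) ≡ true → x ≡ true ⊎ y ≡ true
∨-≡-true⁻ {true} _ = inj₁ refl
∨-≡-true⁻ {false} y≡true = inj₂ y≡true

∨-≡-false : ∀ {x y} → (x ∨ y) ≡ false → x ≡ false × y ≡ false
∨-≡-false {false} y≡false = refl , y≡false

Vec-ext : {xs ys : Vec A n} → (∀ i → lookup xs i ≡ lookup ys i) → xs ≡ ys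
Vec-ext {xs = xs} {ys} eq = trans (sym (tabulate∘lookup xs)) (trans (tabulate-cong eq) (tabulate∘lookup ys))

lookup-∷ʳ-fromℕ : (xs : Vec A n) (y : A) → lookup (xs ∷ʳ y) (fromℕ n) ≡ y
lookup-∷ʳ-fromℕ [] y = refl
lookup-∷ʳ-fromℕ (x ∷ xs) y = lookup-∷ʳ-fromℕ xs y

lookup-∷ʳ-inject₁ : (xs : Vec A n) (y : A) (i : Fin n) → lookup (xs ∷ʳ y) (inject₁ i) ≡ lookup xs i
lookup-∷ʳ-inject₁ (x ∷ xs) y zero = refl
lookup-∷ʳ-inject₁ (x ∷ xs) y (suc i) = lookup-∷ʳ-inject₁ xs y i

lookup-reverse-opposite : (xs : Vec A n) (i : Fin n) → lookup (reverse xs) (opposite i) ≡ lookup xs i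
lookup-reverse-opposite (x ∷ xs) zero =
  trans (cong (λ v → lookup v (opposite zero)) (reverse-∷ x xs)) (lookup-∷ʳ-fromℕ (reverse xs) x)
lookup-reverse-opposite (x ∷ xs) (suc i) =
  trans (cong (λ v → lookup v (opposite (suc i))) (reverse-∷ x xs))
        (trans (lookup-∷ʳ-inject₁ (reverse xs) x (opposite i)) (lookup-reverse-opposite xs i))

lookup-reverse : (xs : Vec A n) (i : Fin n) → lookup (reverse xs) i ≡ lookup xs (opposite i)
lookup-reverse xs i =
  trans (cong (lookup (reverse xs)) (sym (opposite-involutive i))) (lookup-reverse-opposite xs (opposite i))

lookup-transpose : ∀ {m} (M : Vec (Vec A n) m) i j → lookup (lookup (transpose M) i) j ≡ lookup (lookup M j) i
lookup-transpose {n = n} {m = suc m} (row ∷ rows) i j = trans (cong (λ v → lookup v j) column) (by-row j)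
  where
  column : lookup (transpose (row ∷ rows)) i ≡ lookup row i ∷ lookup (transpose rows) i
  column = trans (lookup-⊛ i (replicate n Vec._∷_ ⊛ row) (transpose rows))
             (cong (λ f → f (lookup (transpose rows) i))
               (trans (lookup-⊛ i (replicate n (Vec._∷_ {n = m})) row)
                      (cong (λ f → f (lookup row i)) (lookup-replicate i (Vec._∷_ {n = m})))))
  by-row : ∀ j → lookup (lookup row i ∷ lookup (transpose rows) i) j ≡ lookup (lookup (row ∷ rows) j) i
  by-row zero = refl
  by-row (suc j) = lookup-transpose rows i j

lookup-removeAt : ∀ {n} (xs : Vec A (suc n)) (r : Fin (suc n)) (i : Fin n) →
  lookup (removeAt xs r) i ≡ lookup xs (punchIn r i)
lookup-removeAt xs r i =
  trans (cong (lookup (removeAt xs r)) (sym (punchOut-punchIn r))) (removeAt-punchOut xs (punchInᵢ≢i r i ∘ sym))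

toℕ-punchIn : ∀ {n} (r : Fin (suc n)) (i : Fin n) →
  (toℕ i < toℕ r × toℕ (punchIn r i) ≡ toℕ i) ⊎ (toℕ r ≤ toℕ i × toℕ (punchIn r i) ≡ suc (toℕ i))
toℕ-punchIn zero i = inj₂ (z≤n , refl)
toℕ-punchIn (suc r) zero = inj₁ (s≤s z≤n , refl)
toℕ-punchIn (suc r) (suc i) with toℕ-punchIn r i
... | inj₁ (i<r , e) = inj₁ (s≤s i<r , cong suc e)
... | inj₂ (r≤i , e) = inj₂ (s≤s r≤i , cong suc e)

-- Counting with duplicate-free lists

AtMost : ℕ → Pred A 0ℓ → Set
AtMost n P = ∀ xs → Unique xs → All P xs → length xs ≤ n

AtMost-⊆ : {P Q : Pred A 0ℓ} → (∀ {x} → Q x → P x) → AtMost n P → AtMost n Q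
AtMost-⊆ Q⊆P atP xs u qs = atP xs u (All.map Q⊆P qs)

AtMost-reflect : {P : Pred A 0ℓ} {Q : Pred B 0ℓ} (f : ∀ {x} → P x → B) →
  (∀ {x y} (px : P x) (py : P y) → f px ≡ f py → x ≡ y) → (∀ {x} (px : P x) → Q (f px)) →
  AtMost n Q → AtMost n P
AtMost-reflect {P = P} {Q} f f-inj f-into atQ xs u ps =
  subst (_≤ _) (length-image ps) (atQ (image ps) (image-unique u ps) (image-into ps))
  where
  image : ∀ {xs} → All P xs → List _
  image [] = []
  image (px ∷ ps) = f px ∷ image ps
  length-image : ∀ {xs} (ps : All P xs) → length (image ps) ≡ length xs
  length-image [] = refl
  length-image (_ ∷ ps) = cong suc (length-image ps)
  image-into : ∀ {xs} (ps : All P xs) → All Q (image ps)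
  image-into [] = []
  image-into (px ∷ ps) = f-into px ∷ image-into ps
  image-fresh : ∀ {x xs} (px : P x) (ps : All P xs) → All (x ≢_) xs → All (f px ≢_) (image ps)
  image-fresh px [] [] = []
  image-fresh px (py ∷ ps) (x≢y ∷ x∉) = (x≢y ∘ f-inj px py) ∷ image-fresh px ps x∉
  image-unique : ∀ {xs} → Unique xs → (ps : All P xs) → Unique (image ps)
  image-unique [] [] = []
  image-unique (x∉ ∷ u) (px ∷ ps) = image-fresh px ps x∉ ∷ image-unique u ps

AtMost-preimage : {P : Pred B 0ℓ} (f : A → B) → (∀ {x y} → f x ≡ f y → x ≡ y) → AtMost n P → AtMost n (P ∘ f)
AtMost-preimage f f-inj = AtMost-reflect (λ {x} _ → f x) (λ _ _ → f-inj) (λ px → px)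

AtMost-≡ : {c : A} → AtMost 1 (_≡ c)
AtMost-≡ [] _ _ = z≤n
AtMost-≡ (_ ∷ []) _ _ = s≤s z≤n
AtMost-≡ (_ ∷ _ ∷ _) ((x≢y ∷ _) ∷ _) (refl ∷ refl ∷ _) = contradiction refl x≢y

AtMost-inhabited : {P : Pred A 0ℓ} {x : A} → AtMost n P → P x → 1 ≤ n
AtMost-inhabited atP px = atP (_ ∷ []) ([] ∷ []) (px ∷ [])

AtMost-two : {P : Pred A 0ℓ} {x y : A} → AtMost n P → x ≢ y → P x → P y → 2 ≤ n
AtMost-two atP x≢y px py = atP (_ ∷ _ ∷ []) ((x≢y ∷ []) ∷ [] ∷ []) (px ∷ py ∷ [])

AtMost-remove : {P : Pred A 0ℓ} {x : A} → AtMost n P → P x → AtMost (n ∸ 1) (P ∩ (x ≢_))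
AtMost-remove atP px xs u ps = ∸-monoˡ-≤ 1 (atP (_ ∷ xs) (All.map proj₂ ps ∷ u) (px ∷ All.map proj₁ ps))

AtMost-⊎ : {P Q : Pred A 0ℓ} → AtMost m P → AtMost n Q → AtMost (m + n) (P ∪ Q)
AtMost-⊎ atP atQ [] _ _ = z≤n
AtMost-⊎ {m = zero} atP atQ _ _ (inj₁ px ∷ _) = contradiction (AtMost-inhabited atP px) λ ()
AtMost-⊎ {m = suc m} {P = P} {Q} atP atQ (x ∷ xs) (x∉ ∷ u) (inj₁ px ∷ ps) =
  s≤s (AtMost-⊎ (AtMost-remove atP px) atQ xs u (All.zipWith shrink (x∉ , ps)))
  where
  shrink : ∀ {y} → x ≢ y × (P ∪ Q) y → (P ∩ (x ≢_) ∪ Q) y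
  shrink (x≢y , inj₁ py) = inj₁ (py , x≢y)
  shrink (_ , inj₂ qy) = inj₂ qy
AtMost-⊎ {n = zero} atP atQ _ _ (inj₂ qx ∷ _) = contradiction (AtMost-inhabited atQ qx) λ ()
AtMost-⊎ {m = m} {n = suc n} {P = P} {Q} atP atQ (x ∷ xs) (x∉ ∷ u) (inj₂ qx ∷ ps) =
  subst (suc (length xs) ≤_) (sym (+-suc m n))
    (s≤s (AtMost-⊎ atP (AtMost-remove atQ qx) xs u (All.zipWith shrink (x∉ , ps))))
  where
  shrink : ∀ {y} → x ≢ y × (P ∪ Q) y → (P ∪ Q ∩ (x ≢_)) y
  shrink (_ , inj₁ py) = inj₁ py
  shrink (x≢y , inj₂ qy) = inj₂ (qy , x≢y)

AtMost-Any : {I : Set} {P : I → Pred A 0ℓ} (w : I → ℕ) (E : List I) → (∀ d → AtMost (w d) (P d)) →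
  AtMost (sum (map w E)) (λ x → Any (λ d → P d x) E)
AtMost-Any w [] atP [] _ _ = z≤n
AtMost-Any w [] atP (x ∷ _) _ (() ∷ _)
AtMost-Any {P = P} w (d ∷ E) atP xs u ps =
  AtMost-⊎ (atP d) (AtMost-Any w E atP) xs u (All.map split ps)
  where
  split : ∀ {x} → Any (λ d → P d x) (d ∷ E) → (P d x ⊎ Any (λ d → P d x) E)
  split (here p) = inj₁ p
  split (there p) = inj₂ p

AtMost-Fin : ∀ k → AtMost k (U {A = Fin k})
AtMost-Fin zero [] _ _ = z≤n
AtMost-Fin (suc k) = AtMost-⊆ zero-or-suc (AtMost-⊎ AtMost-≡ (AtMost-reflect proj₁ suc-inj (λ _ → tt) (AtMost-Fin k)))
  where
  IsSuc : Pred (Fin (suc k)) 0ℓ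
  IsSuc x = ∃ λ (y : Fin k) → x ≡ suc y
  zero-or-suc : ∀ {x} → ⊤ → (x ≡ zero) ⊎ IsSuc x
  zero-or-suc {zero} _ = inj₁ refl
  zero-or-suc {suc y} _ = inj₂ (y , refl)
  suc-inj : ∀ {x x'} (p : IsSuc x) (p' : IsSuc x') → proj₁ p ≡ proj₁ p' → x ≡ x'
  suc-inj (_ , refl) (_ , refl) refl = refl

ConsOf : Pred A 0ℓ → (A → Pred (List A) 0ℓ) → Pred (List A) 0ℓ
ConsOf H Q w = ∃₂ λ x t → w ≡ x ∷ t × H x × Q x t

AtMost-ConsOf : {H : Pred A 0ℓ} {Q : A → Pred (List A) 0ℓ} → DecidableEquality A →
  AtMost m H → (∀ {x} → H x → AtMost n (Q x)) → AtMost (m * n) (ConsOf H Q)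
AtMost-ConsOf _ _ _ [] _ _ = z≤n
AtMost-ConsOf {m = zero} _ atH _ _ _ ((_ , _ , _ , hx , _) ∷ _) = contradiction (AtMost-inhabited atH hx) λ ()
AtMost-ConsOf {m = suc m} {n = n} {H = H} {Q} _≟_ atH atQ ws@(_ ∷ _) u cs@((x , _ , _ , hx , _) ∷ _) =
  AtMost-⊎ fibre (AtMost-ConsOf {m = m} _≟_ (AtMost-remove atH hx) (atQ ∘ proj₁)) ws u (All.map classify cs)
  where
  Fibre : Pred (List _) 0ℓ
  Fibre w = ∃ λ t → w ≡ x ∷ t × Q x t
  fibre : AtMost n Fibre
  fibre = AtMost-reflect proj₁ (λ { (_ , refl , _) (_ , refl , _) refl → refl }) (proj₂ ∘ proj₂) (atQ hx)
  classify : ∀ {w} → ConsOf H Q w → (Fibre ∪ ConsOf (H ∩ (x ≢_)) Q) w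
  classify (y , t , w≡ , hy , q) with x ≟ y
  ... | yes refl = inj₁ (t , w≡ , q)
  ... | no x≢y = inj₂ (y , t , w≡ , (hy , x≢y) , q)

Arrangement : ℕ → ℕ → Pred A 0ℓ → Pred A 0ℓ → Pred (List A) 0ℓ
Arrangement n₁ n₂ P R w = length w ≡ n₁ + n₂ × Unique w × All P (take n₁ w) × All R w

AtMost-Arrangement : {P R : Pred A 0ℓ} {p r : ℕ} → DecidableEquality A → ∀ n₁ n₂ →
  AtMost p P → AtMost r R → AtMost (fallingFactorial p n₁ * fallingFactorial (r ∸ n₁) n₂) (Arrangement n₁ n₂ P R)
AtMost-Arrangement _ zero zero _ _ =
  AtMost-⊆ (λ { {[]} _ → refl }) AtMost-≡
AtMost-Arrangement {P = P} {R} {p} {r} _≟_ zero (suc n₂) atP atR xs u as = begin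
  length xs
    ≤⟨ AtMost-ConsOf _≟_ atR (λ rx → AtMost-Arrangement _≟_ zero n₂ atP (AtMost-remove atR rx)) xs u (All.map uncons as) ⟩
  r * (1 * fallingFactorial (r ∸ 1) n₂)        ≡⟨ cong (r *_) (*-identityˡ _) ⟩
  r * fallingFactorial (r ∸ 1) n₂              ≡⟨ *-identityˡ _ ⟨
  1 * fallingFactorial r (suc n₂)              ∎
  where
  open ≤-Reasoning
  uncons : ∀ {w} → Arrangement zero (suc n₂) P R w → ConsOf R (λ x → Arrangement zero n₂ P (R ∩ (x ≢_))) w
  uncons {x ∷ t} (len , x∉ ∷ ut , [] , rx ∷ rt) = x , t , refl , rx , suc-injective len , ut , [] , All.zip (rt , x∉)
AtMost-Arrangement {P = P} {R} {p} {r} _≟_ (suc n₁) n₂ atP atR xs u as =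
  begin
    length xs
      ≤⟨ AtMost-ConsOf _≟_ (AtMost-⊆ proj₁ atP)
           (λ (px , rx) → AtMost-Arrangement _≟_ n₁ n₂ (AtMost-remove atP px) (AtMost-remove atR rx)) xs u (All.map uncons as) ⟩
    p * (fallingFactorial (p ∸ 1) n₁ * fallingFactorial (r ∸ 1 ∸ n₁) n₂) ≡⟨ *-assoc p _ _ ⟨
    p * fallingFactorial (p ∸ 1) n₁ * fallingFactorial (r ∸ 1 ∸ n₁) n₂
      ≡⟨ cong (λ s → p * fallingFactorial (p ∸ 1) n₁ * fallingFactorial s n₂) (∸-+-assoc r 1 n₁) ⟩
    fallingFactorial p (suc n₁) * fallingFactorial (r ∸ suc n₁) n₂ ∎
  where
  open ≤-Reasoning
  uncons : ∀ {w} → Arrangement (suc n₁) n₂ P R w → ConsOf (P ∩ R) (λ x → Arrangement n₁ n₂ (P ∩ (x ≢_)) (R ∩ (x ≢_))) w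
  uncons {x ∷ t} (len , x∉ ∷ ut , px ∷ pt , rx ∷ rt) =
    x , t , refl , (px , rx) , suc-injective len , ut , All.zip (pt , take⁺ n₁ x∉) , All.zip (rt , x∉)

members : ∀ {k} → (Fin k → Bool) → Bool → List (Fin k)
members {k} S b = filter (λ x → S x Bool.≟ b) (allFin k)

module _ {k : ℕ} (S : Fin k → Bool) where

  members-unique : ∀ b → Unique (members S b)
  members-unique b = filter⁺ _ (allFin⁺ k)

  members-all : ∀ b → All (λ x → S x ≡ b) (members S b)
  members-all b = all-filter _ (allFin k)

  ∈-members : ∀ {x} → x ∈ members S (S x)
  ∈-members {x} = ∈-filter⁺ _ (∈-allFin x) refl

  length-members : length (members S true) + length (members S false) ≡ k
  length-members = trans (count (allFin k)) (length-tabulate {n = k} (λ x → x))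
    where
    count : ∀ xs → length (filter (λ x → S x Bool.≟ true) xs) + length (filter (λ x → S x Bool.≟ false) xs) ≡ length xs
    count [] = refl
    count (x ∷ xs) with S x
    ... | true = cong suc (count xs)
    ... | false = trans (+-suc _ _) (cong suc (count xs))

large-subset-≤ : ∀ {k m n} {S : Fin k → Bool} {P : Pred (Fin k) 0ℓ} →
  AtMost m (λ x → S x ≡ false) → AtMost n P → (∀ {x} → S x ≡ true → P x) → k ∸ m ≤ n
large-subset-≤ {k} {m} {n} {S} atS̄ atP S⇒P = begin
  k ∸ m                                ≤⟨ ∸-monoʳ-≤ k (atS̄ _ (members-unique S false) (members-all S false)) ⟩
  k ∸ length (members S false)         ≡⟨ cong (_∸ length (members S false)) (sym (length-members S)) ⟩
  length (members S true) + length (members S false) ∸ length (members S false)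
                                       ≡⟨ m+n∸n≡m (length (members S true)) (length (members S false)) ⟩
  length (members S true)              ≤⟨ atP _ (members-unique S true) (All.map S⇒P (members-all S true)) ⟩
  n                                    ∎
  where open ≤-Reasoning

interval : ∀ {k} → ℕ → ℕ → Fin k → Bool
interval lo hi i = (lo ≤ᵇ toℕ i) ∧ (toℕ i <ᵇ hi)

module _ {k : ℕ} where

  interval⇒In : ∀ {lo hi} {i : Fin k} → interval lo hi i ≡ true → In lo hi i
  interval⇒In {lo} {hi} {i} e with T-∧ .Equivalence.to (T-≡ .Equivalence.from e)
  ... | lo≤i , i<hi = ≤ᵇ⇒≤ lo (toℕ i) lo≤i , <ᵇ⇒< (toℕ i) hi i<hi

  In⇒interval : ∀ {lo hi} {i : Fin k} → In lo hi i → interval lo hi i ≡ true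
  In⇒interval (lo≤i , i<hi) = T-≡ .Equivalence.to (T-∧ .Equivalence.from (≤⇒≤ᵇ lo≤i , <⇒<ᵇ i<hi))

  interval-false : ∀ {lo hi} {i : Fin k} → interval lo hi i ≡ false → toℕ i < lo ⊎ hi ≤ toℕ i
  interval-false {lo} {hi} {i} e with lo ≤? toℕ i | toℕ i <? hi
  ... | no lo≰i | _ = inj₁ (≰⇒> lo≰i)
  ... | yes _ | no i≮hi = inj₂ (≮⇒≥ i≮hi)
  ... | yes lo≤i | yes i<hi = contradiction (trans (sym e) (In⇒interval (lo≤i , i<hi))) λ ()

  AtMost-In : ∀ {lo hi} → AtMost (hi ∸ lo) (In {k} lo hi)
  AtMost-In {lo} {hi} = AtMost-reflect offset offset-injective (λ _ → tt) (AtMost-Fin (hi ∸ lo))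
    where
    offset : ∀ {i : Fin k} → In lo hi i → Fin (hi ∸ lo)
    offset (lo≤i , i<hi) = fromℕ< (∸-monoˡ-< i<hi lo≤i)
    offset-injective : ∀ {i i' : Fin k} (p : In lo hi i) (p' : In lo hi i') → offset p ≡ offset p' → i ≡ i'
    offset-injective {i} {i'} p@(lo≤i , _) p'@(lo≤i' , _) e = toℕ-injective (begin
      toℕ i                 ≡⟨ m+[n∸m]≡n lo≤i ⟨
      lo + (toℕ i ∸ lo)     ≡⟨ cong (lo +_) (trans (sym (toℕ-fromℕ< _)) (trans (cong toℕ e) (toℕ-fromℕ< _))) ⟩
      lo + (toℕ i' ∸ lo)    ≡⟨ m+[n∸m]≡n lo≤i' ⟩
      toℕ i'                ∎)
      where open ≡-Reasoning

  AtMost-interval : ∀ {lo hi} → AtMost (hi ∸ lo) (λ i → interval {k} lo hi i ≡ true)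
  AtMost-interval {lo} {hi} = AtMost-⊆ (interval⇒In {lo} {hi}) AtMost-In

  AtMost-interval-false : ∀ {lo hi} → AtMost (lo + (k ∸ hi)) (λ i → interval {k} lo hi i ≡ false)
  AtMost-interval-false {lo} {hi} = AtMost-⊆ outside (AtMost-⊎ (AtMost-In {lo = 0} {hi = lo}) (AtMost-In {lo = hi} {hi = k}))
    where
    outside : ∀ {i : Fin k} → interval lo hi i ≡ false → In 0 lo i ⊎ In hi k i
    outside {i} e with interval-false e
    ... | inj₁ i<lo = inj₁ (z≤n , i<lo)
    ... | inj₂ hi≤i = inj₂ (hi≤i , toℕ<n i)

  interval-size-≤ : ∀ {lo hi n} {P : Pred (Fin k) 0ℓ} → hi ≤ k → AtMost n P → (∀ {i} → In lo hi i → P i) → hi ∸ lo ≤ n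
  interval-size-≤ {lo} {hi} {n} hi≤k atP In⇒P =
    subst (_≤ n) complement-size (large-subset-≤ (AtMost-interval-false {lo} {hi}) atP (In⇒P ∘ interval⇒In {lo} {hi}))
    where
    complement-size : k ∸ (lo + (k ∸ hi)) ≡ hi ∸ lo
    complement-size = trans (cong (k ∸_) (+-comm lo (k ∸ hi))) (trans (sym (∸-+-assoc k (k ∸ hi) lo)) (cong (_∸ lo) (m∸[m∸n]≡n hi≤k)))

AtMost-adjacent : ∀ {k} r → AtMost 2 (λ (i : Fin k) → toℕ i ≡ r ⊎ toℕ i ≡ suc r)
AtMost-adjacent r = AtMost-⊎ (AtMost-preimage toℕ toℕ-injective AtMost-≡) (AtMost-preimage toℕ toℕ-injective AtMost-≡)

-- Permutation matrices

module _ {k : ℕ} (Q : Matrix k) (pm : IsPermMatrix Q) where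

  rowOf colOf : Fin k → Fin k
  rowOf j = proj₁ (proj₂ pm j)
  colOf i = proj₁ (proj₁ pm i)

  rowOf-one : ∀ j → One Q (rowOf j) j
  rowOf-one j = proj₁ (proj₂ (proj₂ pm j))

  colOf-one : ∀ i → One Q i (colOf i)
  colOf-one i = proj₁ (proj₂ (proj₁ pm i))

  rowOf-unique : ∀ {i j} → One Q i j → i ≡ rowOf j
  rowOf-unique {i} {j} = proj₂ (proj₂ (proj₂ pm j)) i

  colOf-unique : ∀ {i j} → One Q i j → j ≡ colOf i
  colOf-unique {i} {j} = proj₂ (proj₂ (proj₁ pm i)) j

  rowOf-injective : ∀ {j j'} → rowOf j ≡ rowOf j' → j ≡ j'
  rowOf-injective {j} {j'} e =
    trans (colOf-unique (rowOf-one j)) (sym (colOf-unique (subst (λ i → One Q i j') (sym e) (rowOf-one j'))))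

  colOf-injective : ∀ {i i'} → colOf i ≡ colOf i' → i ≡ i'
  colOf-injective {i} {i'} e =
    trans (rowOf-unique (colOf-one i)) (sym (rowOf-unique (subst (One Q i') (sym e) (colOf-one i'))))

  ones-in-distinct-rows : ∀ {i i' j j'} → One Q i j → One Q i' j' → i ≢ i' → j ≢ j'
  ones-in-distinct-rows o o' i≢i' refl = i≢i' (trans (rowOf-unique o) (sym (rowOf-unique o')))

PermMatrix-ext : ∀ {k} {Q Q' : Matrix k} (pm : IsPermMatrix Q) (pm' : IsPermMatrix Q') →
  (∀ j → rowOf Q pm j ≡ rowOf Q' pm' j) → Q ≡ Q'
PermMatrix-ext {Q = Q} {Q'} pm pm' same = Vec-ext λ i → Vec-ext λ j → Bool-ext
  (λ o → subst (λ r → One Q' r j) (sym (trans (rowOf-unique Q pm o) (same j))) (rowOf-one Q' pm' j))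
  (λ o → subst (λ r → One Q r j) (sym (trans (rowOf-unique Q' pm' o) (sym (same j)))) (rowOf-one Q pm j))

record MapsInto {k} (Q : Matrix k) (B A : Fin k → Bool) : Set where
  constructor mapsInto
  field into : ∀ {i j} → One Q i j → B j ≡ true → A i ≡ true
open MapsInto public

AtMost-MapsInto : ∀ {k} {A B : Fin k → Bool} {u v} → AtMost u (λ i → A i ≡ true) → AtMost v (λ j → B j ≡ false) →
  AtMost (u ! * v !) (λ Q → IsPermMatrix Q × MapsInto Q B A)
AtMost-MapsInto {k} {A} {B} {u} {v} atA atB Qs uQs ps = begin
  length Qs
    ≤⟨ AtMost-reflect encode encode-injective encode-arrangement (AtMost-Arrangement Fin._≟_ s t atA (AtMost-Fin k)) Qs uQs ps ⟩
  fallingFactorial u s * fallingFactorial (k ∸ s) t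
    ≤⟨ *-mono-≤ (fallingFactorial≤! u s) (≤-trans (fallingFactorial≤! (k ∸ s) t) (!-mono k∸s≤v)) ⟩
  u ! * v ! ∎
  where
  open ≤-Reasoning
  inB = members B true
  outB = members B false
  s = length inB
  t = length outB
  k∸s≤v : k ∸ s ≤ v
  k∸s≤v = subst (_≤ v) (sym (trans (cong (_∸ s) (sym (length-members B))) (m+n∸m≡n s t)))
    (atB outB (members-unique B false) (members-all B false))
  encode : ∀ {Q} → IsPermMatrix Q × MapsInto Q B A → List (Fin k)
  encode {Q} (pm , _) = map (rowOf Q pm) (inB ++ outB)
  ∈-columns : ∀ j → j ∈ inB ++ outB
  ∈-columns j with B j | ∈-members B {j}
  ... | true | j∈ = ∈-++⁺ˡ j∈
  ... | false | j∈ = ∈-++⁺ʳ inB j∈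
  encode-injective : ∀ {Q Q'} (p : IsPermMatrix Q × MapsInto Q B A) (p' : IsPermMatrix Q' × MapsInto Q' B A) → encode p ≡ encode p' → Q ≡ Q'
  encode-injective (pm , _) (pm' , _) e = PermMatrix-ext pm pm' λ j → map-≡-∈ e (∈-columns j)
  encode-arrangement : ∀ {Q} (p : IsPermMatrix Q × MapsInto Q B A) → Arrangement s t (λ i → A i ≡ true) U (encode p)
  encode-arrangement {Q} (pm , Q-maps) =
    trans (length-map _ (inB ++ outB)) (length-++ inB) ,
    map⁺ (rowOf-injective Q pm) (++⁺ (members-unique B true) (members-unique B false) disjoint) ,
    subst (All _) (sym prefix) (All-map⁺ (All.map (into Q-maps (rowOf-one Q pm _)) (members-all B true))) ,
    All.universal (λ _ → tt) _
    where
    prefix : take s (map (rowOf Q pm) (inB ++ outB)) ≡ map (rowOf Q pm) inB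
    prefix = trans (take-map s (inB ++ outB)) (cong (map _) (take-length-++ inB outB))
    disjoint : ∀ {j} → j ∈ inB × j ∈ outB → ⊥
    disjoint (j∈ , j∉) with trans (sym (All.lookup (members-all B true) j∈)) (All.lookup (members-all B false) j∉)
    ... | ()

-- The symmetries of the square

entry : ∀ {k} → Matrix k → Fin k → Fin k → Bool
entry M i j = lookup (lookup M i) j

module _ {k : ℕ} (M : Matrix k) where

  entry-vReflect : ∀ i j → entry (vReflect M) i j ≡ entry M i (opposite j)
  entry-vReflect i j = trans (cong (λ r → lookup r j) (lookup-map i reverse M)) (lookup-reverse (lookup M i) j)

  entry-hReflect : ∀ i j → entry (hReflect M) i j ≡ entry M (opposite i) j
  entry-hReflect i j = cong (λ r → lookup r j) (lookup-reverse M i)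

  entry-transpose : ∀ i j → entry (transpose M) i j ≡ entry M j i
  entry-transpose = lookup-transpose M

IsPermMatrix-reindex : ∀ {k} {M N : Matrix k} (σ τ : Fin k → Fin k) → (∀ i → σ (σ i) ≡ i) → (∀ j → τ (τ j) ≡ j) →
  (∀ i j → entry N i j ≡ entry M (σ i) (τ j)) → IsPermMatrix M → IsPermMatrix N
IsPermMatrix-reindex {M = M} {N} σ τ σσ ττ N≡M (rows , cols) = rows' , cols'
  where
  rows' : ∀ i → ∃ λ j → One N i j × (∀ j' → One N i j' → j' ≡ j)
  rows' i with rows (σ i)
  ... | j , o , uq = τ j , trans (N≡M i (τ j)) (trans (cong (entry M (σ i)) (ττ j)) o) ,
                     λ j' o' → trans (sym (ττ j')) (cong τ (uq (τ j') (trans (sym (N≡M i j')) o')))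
  cols' : ∀ j → ∃ λ i → One N i j × (∀ i' → One N i' j → i' ≡ i)
  cols' j with cols (τ j)
  ... | i , o , uq = σ i , trans (N≡M (σ i) j) (trans (cong (λ r → entry M r (τ j)) (σσ i)) o) ,
                     λ i' o' → trans (sym (σσ i')) (cong σ (uq (σ i') (trans (sym (N≡M i' j)) o')))

IsPermMatrix-transpose : ∀ {k} {M : Matrix k} → IsPermMatrix M → IsPermMatrix (transpose M)
IsPermMatrix-transpose {M = M} (rows , cols) = rows' , cols'
  where
  rows' : ∀ i → ∃ λ j → One (transpose M) i j × (∀ j' → One (transpose M) i j' → j' ≡ j)
  rows' i with cols i
  ... | j , o , uq = j , trans (entry-transpose M i j) o , λ j' o' → uq j' (trans (sym (entry-transpose M i j')) o')
  cols' : ∀ j → ∃ λ i → One (transpose M) i j × (∀ i' → One (transpose M) i' j → i' ≡ i)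
  cols' j with rows j
  ... | i , o , uq = i , trans (entry-transpose M i j) o , λ i' o' → uq i' (trans (sym (entry-transpose M i' j)) o')

IsPermMatrix-vReflect : ∀ {k} {M : Matrix k} → IsPermMatrix M → IsPermMatrix (vReflect M)
IsPermMatrix-vReflect {M = M} = IsPermMatrix-reindex {M = M} {vReflect M} (λ i → i) opposite (λ _ → refl) opposite-involutive (entry-vReflect M)

IsPermMatrix-hReflect : ∀ {k} {M : Matrix k} → IsPermMatrix M → IsPermMatrix (hReflect M)
IsPermMatrix-hReflect {M = M} = IsPermMatrix-reindex {M = M} {hReflect M} opposite (λ j → j) opposite-involutive (λ _ → refl) (entry-hReflect M)

Reaches-IsPermMatrix : ∀ {k} {Q Q' : Matrix k} → Reaches Q Q' → IsPermMatrix Q → IsPermMatrix Q'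
Reaches-IsPermMatrix done = λ pm → pm
Reaches-IsPermMatrix {Q = Q} (stepV r) = Reaches-IsPermMatrix r ∘ IsPermMatrix-vReflect {M = Q}
Reaches-IsPermMatrix {Q = Q} (stepH r) = Reaches-IsPermMatrix r ∘ IsPermMatrix-hReflect {M = Q}
Reaches-IsPermMatrix {Q = Q} (stepR r) = Reaches-IsPermMatrix r ∘ IsPermMatrix-vReflect {M = transpose Q} ∘ IsPermMatrix-transpose {M = Q}

module _ {k : ℕ} {Q : Matrix k} where

  MapsInto-cong : ∀ {A A' B B'} → B' ≗ B → A ≗ A' → MapsInto Q B A → MapsInto Q B' A'
  MapsInto-cong B'≗B A≗A' m = mapsInto λ o b → trans (sym (A≗A' _)) (into m o (trans (sym (B'≗B _)) b))

  MapsInto-vReflect : ∀ {A B} → MapsInto (vReflect Q) B A → MapsInto Q (B ∘ opposite) A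
  MapsInto-vReflect m = mapsInto λ {i} {j} o →
    into m (trans (entry-vReflect Q i (opposite j)) (trans (cong (entry Q i) (opposite-involutive j)) o))

  MapsInto-hReflect : ∀ {A B} → MapsInto (hReflect Q) B A → MapsInto Q B (A ∘ opposite)
  MapsInto-hReflect m = mapsInto λ {i} {j} o →
    into m (trans (entry-hReflect Q (opposite i) j) (trans (cong (λ r → entry Q r j) (opposite-involutive i)) o))

  -- contrapositive: a one at (i, j) with j outside A forces i outside B
  MapsInto-transpose : ∀ {A B} → MapsInto (transpose Q) B A → MapsInto Q (not ∘ A) (not ∘ B)
  MapsInto-transpose {A} {B} m = mapsInto into′
    where
    into′ : ∀ {i j} → One Q i j → not (A j) ≡ true → not (B i) ≡ true
    into′ {i} {j} o ¬Aj with B i in Bi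
    ... | false = refl
    ... | true = contradiction (subst (λ b → not b ≡ true) (into m (trans (entry-transpose Q j i) o) Bi) ¬Aj) λ ()

record Descriptor (k : ℕ) : Set where
  field
    rowSet colSet : Fin k → Bool
    u v : ℕ
    rowSet-atMost : AtMost u (λ i → rowSet i ≡ true)
    colSet-coAtMost : AtMost v (λ j → colSet j ≡ false)

Event : ∀ {k} → Matrix k → Descriptor k → Set
Event Q d = MapsInto Q (Descriptor.colSet d) (Descriptor.rowSet d)

weight : ∀ {k} → Descriptor k → ℕ
weight d = Descriptor.u d ! * Descriptor.v d !

AtMost-Event : ∀ {k} (d : Descriptor k) → AtMost (weight d) (λ Q → IsPermMatrix Q × Event Q d)
AtMost-Event d = AtMost-MapsInto (Descriptor.rowSet-atMost d) (Descriptor.colSet-coAtMost d)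

-- (t , x , y) stands for: reflect the rows if x, the columns if y, and transpose if t.
Symmetry : Set
Symmetry = Bool × Bool × Bool

reflectIf : ∀ {k} → Bool → Fin k → Fin k
reflectIf b i = if b then opposite i else i

reflectIf-injective : ∀ {k} b {i j : Fin k} → reflectIf b i ≡ reflectIf b j → i ≡ j
reflectIf-injective false e = e
reflectIf-injective true {i} {j} e = trans (sym (opposite-involutive i)) (trans (cong opposite e) (opposite-involutive j))

reflectIf-opposite : ∀ {k} b (i : Fin k) → reflectIf b (opposite i) ≡ reflectIf (not b) i
reflectIf-opposite false i = refl
reflectIf-opposite true i = opposite-involutive i

act : ∀ {k} → Symmetry → Descriptor k → Descriptor k
act (false , x , y) d = record
  { rowSet = rowSet ∘ reflectIf x ; colSet = colSet ∘ reflectIf y ; u = u ; v = v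
  ; rowSet-atMost = AtMost-preimage (reflectIf x) (reflectIf-injective x) rowSet-atMost
  ; colSet-coAtMost = AtMost-preimage (reflectIf y) (reflectIf-injective y) colSet-coAtMost }
  where open Descriptor d
act (true , x , y) d = record
  { rowSet = not ∘ colSet ∘ reflectIf x ; colSet = not ∘ rowSet ∘ reflectIf y ; u = v ; v = u
  ; rowSet-atMost = AtMost-⊆ (not-injective {y = false}) (AtMost-preimage (reflectIf x) (reflectIf-injective x) colSet-coAtMost)
  ; colSet-coAtMost = AtMost-⊆ (not-injective {y = true}) (AtMost-preimage (reflectIf y) (reflectIf-injective y) rowSet-atMost) }
  where open Descriptor d

weight-act : ∀ {k} g (d : Descriptor k) → weight (act g d) ≡ weight d
weight-act (false , _) d = refl
weight-act (true , _) d = *-comm (Descriptor.v d !) (Descriptor.u d !)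

flipRows flipCols swapAxes : Symmetry → Symmetry
flipRows (t , x , y) = t , not x , y
flipCols (t , x , y) = t , x , not y
swapAxes (t , x , y) = not t , y , x

module _ {k : ℕ} {Q : Matrix k} (d : Descriptor k) where
  open Descriptor d

  Event-vReflect : ∀ g → Event (vReflect Q) (act g d) → Event Q (act (flipCols g) d)
  Event-vReflect (false , x , y) = MapsInto-cong (λ j → sym (cong colSet (reflectIf-opposite y j))) (λ _ → refl) ∘ MapsInto-vReflect
  Event-vReflect (true , x , y) = MapsInto-cong (λ j → sym (cong (not ∘ rowSet) (reflectIf-opposite y j))) (λ _ → refl) ∘ MapsInto-vReflect

  Event-hReflect : ∀ g → Event (hReflect Q) (act g d) → Event Q (act (flipRows g) d)
  Event-hReflect (false , x , y) = MapsInto-cong (λ _ → refl) (λ i → cong rowSet (reflectIf-opposite x i)) ∘ MapsInto-hReflect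
  Event-hReflect (true , x , y) = MapsInto-cong (λ _ → refl) (λ i → cong (not ∘ colSet) (reflectIf-opposite x i)) ∘ MapsInto-hReflect

  Event-transpose : ∀ g → Event (transpose Q) (act g d) → Event Q (act (swapAxes g) d)
  Event-transpose (false , x , y) = MapsInto-transpose
  Event-transpose (true , x , y) = MapsInto-cong (λ _ → sym (not-involutive _)) (λ _ → not-involutive _) ∘ MapsInto-transpose

Reaches-Event : ∀ {k} {Q Q' : Matrix k} → Reaches Q Q' → ∀ d g → Event Q' (act g d) → ∃ λ g' → Event Q (act g' d)
Reaches-Event done d g e = g , e
Reaches-Event (stepV r) d g e with Reaches-Event r d g e
... | g' , e' = flipCols g' , Event-vReflect d g' e'
Reaches-Event (stepH r) d g e with Reaches-Event r d g e
... | g' , e' = flipRows g' , Event-hReflect d g' e'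
Reaches-Event (stepR r) d g e with Reaches-Event r d g e
... | g' , e' = swapAxes (flipCols g') , Event-transpose d (flipCols g') (Event-vReflect d g' e')

symmetries : List Symmetry
symmetries = cartesianProduct bools (cartesianProduct bools bools)
  where bools = true ∷ false ∷ []

∈-symmetries : ∀ g → g ∈ symmetries
∈-symmetries (t , x , y) = ∈-cartesianProduct⁺ (∈-bools t) (∈-cartesianProduct⁺ (∈-bools x) (∈-bools y))
  where
  ∈-bools : ∀ b → b ∈ true ∷ false ∷ []
  ∈-bools true = here refl
  ∈-bools false = there (here refl)

InOrbit : ∀ {k} → List (Descriptor k) → Matrix k → Set
InOrbit E Q = Any (λ g → Any (λ d → IsPermMatrix Q × Event Q (act g d)) E) symmetries

AtMost-InOrbit : ∀ {k} (E : List (Descriptor k)) → AtMost (8 * sum (map weight E)) (InOrbit E)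
AtMost-InOrbit E = subst (λ n → AtMost n (InOrbit E)) orbit-weight
  (AtMost-Any (λ g → sum (map (weight ∘ act g) E)) symmetries λ g → AtMost-Any (weight ∘ act g) E (AtMost-Event ∘ act g))
  where
  orbit-weight : sum (map (λ g → sum (map (weight ∘ act g) E)) symmetries) ≡ 8 * sum (map weight E)
  orbit-weight = cong sum (map-cong (λ g → cong sum (map-cong (weight-act g) E)) symmetries)

ReducesTo-InOrbit : ∀ {k} {C : Matrix k → Set} (E : List (Descriptor k)) →
  (∀ {Q'} → IsPermMatrix Q' → C Q' → Any (Event Q') E) → ∀ {Q} → IsPermMatrix Q → ReducesTo C Q → InOrbit E Q
ReducesTo-InOrbit E C⇒E pm (Q' , r , c) with find (C⇒E (Reaches-IsPermMatrix r pm) c)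
... | d , d∈E , e with Reaches-Event r d (false , false , false) e
... | g , e' = lose (∈-symmetries g) (lose d∈E (pm , e'))

-- The four classes

-- Columns [0, c) of Class 1 go into R₁, which has at most c + 2 rows; in Classes 2 and 3 they go
-- into R₂ (shifted by the moved row in Class 3), of height at most c + 2; in Class 4 the columns
-- C₁ ∪ C₃ go into R₂, whose height is exactly |C₁ ∪ C₃|. Some row lies below these blocks, hence
-- the cap at k − 1.
module _ {k : ℕ} where

  cappedBelow : ℕ → ℕ
  cappedBelow x = x ⊓ pred k

  descriptor₁ : ℕ → Descriptor k
  descriptor₁ c = record
    { rowSet = interval 0 (cappedBelow (c + 2)) ; colSet = interval 0 c ; u = cappedBelow (c + 2) ; v = k ∸ c
    ; rowSet-atMost = AtMost-interval {lo = 0} {hi = cappedBelow (c + 2)} ; colSet-coAtMost = AtMost-interval-false {lo = 0} {hi = c} }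

  descriptor₂ : ℕ → ℕ → Descriptor k
  descriptor₂ a c = record
    { rowSet = interval a (cappedBelow (a + c + 2)) ; colSet = interval 0 c ; u = cappedBelow (a + c + 2) ∸ a ; v = k ∸ c
    ; rowSet-atMost = AtMost-interval {lo = a} {hi = cappedBelow (a + c + 2)} ; colSet-coAtMost = AtMost-interval-false {lo = 0} {hi = c} }

  descriptor₃ : ℕ → ℕ → Descriptor k
  descriptor₃ a c = record
    { rowSet = λ i → interval 0 1 i ∨ interval (suc a) (cappedBelow (a + c + 2)) i ; colSet = interval 0 c
    ; u = 1 + (cappedBelow (a + c + 2) ∸ suc a) ; v = k ∸ c
    ; rowSet-atMost =
        AtMost-⊆ ∨-≡-true⁻ (AtMost-⊎ (AtMost-interval {lo = 0} {hi = 1}) (AtMost-interval {lo = suc a} {hi = cappedBelow (a + c + 2)}))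
    ; colSet-coAtMost = AtMost-interval-false {lo = 0} {hi = c} }

  outerColumns : ℕ → ℕ → Fin k → Bool
  outerColumns s c j = interval 0 c j ∨ interval (c + (k ∸ s)) k j

  descriptor₄ : ℕ → ℕ → ℕ → Descriptor k
  descriptor₄ s a c = record
    { rowSet = interval a (a + s) ; colSet = outerColumns s c ; u = s ; v = k ∸ s
    ; rowSet-atMost = subst (λ n → AtMost n (λ i → interval a (a + s) i ≡ true)) (m+n∸m≡n a s) (AtMost-interval {lo = a} {hi = a + s})
    ; colSet-coAtMost = subst (λ n → AtMost n (λ j → outerColumns s c j ≡ false)) (m+n∸m≡n c (k ∸ s))
        (AtMost-⊆ between-blocks (AtMost-In {lo = c} {hi = c + (k ∸ s)})) }
    where
    between-blocks : ∀ {j} → outerColumns s c j ≡ false → In c (c + (k ∸ s)) j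
    between-blocks {j} e with ∨-≡-false e
    ... | left , right with interval-false {lo = 0} {hi = c} left | interval-false {lo = c + (k ∸ s)} {hi = k} right
    ... | inj₁ () | _
    ... | inj₂ c≤j | inj₁ j<end = c≤j , j<end
    ... | inj₂ _ | inj₂ k≤j = contradiction (toℕ<n j) (≤⇒≯ k≤j)

module _ {k : ℕ} where

  family₁ family₂ family₃ family₄ : List (Descriptor k)
  family₁ = map descriptor₁ (between 1 k)
  family₂ = concatMap (λ a → map (descriptor₂ a) (between 2 k)) (between 1 (pred k))
  family₃ = concatMap (λ a → map (descriptor₃ a) (between 2 k)) (between 1 (pred k))
  family₄ = concatMap (λ s → concatMap (λ a → map (descriptor₄ s a) (between 1 s)) (between 1 (k ∸ s))) (between 2 (pred k))

Class1⇒family₁ : ∀ {k} {Q : Matrix k} → IsPermMatrix Q → Class1 Q → Any (Event Q) (family₁ {k})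
Class1⇒family₁ {k} {Q} pm (a , c , _ , a<k , 0<c , c<k , _ , _ , blocks , r , adjacent) =
  Any.map⁺ (lose (∈-between 0<c c<k) event)
  where
  C₁-rows : ∀ {i j} → One Q i j → toℕ j < c → toℕ i < a
  C₁-rows o j<c with blocks _ _ o
  ... | inj₁ ((_ , i<a) , _) = i<a
  ... | inj₂ (inj₁ (_ , c≤j , _)) = contradiction j<c (≤⇒≯ c≤j)
  ... | inj₂ (inj₂ (_ , c≤j , _)) = contradiction j<c (≤⇒≯ c≤j)
  R₁-fate : ∀ {i} → In 0 a i → In 0 c (colOf Q pm i) ⊎ (toℕ i ≡ r ⊎ toℕ i ≡ suc r)
  R₁-fate {i} (_ , i<a) with blocks i _ (colOf-one Q pm i)
  ... | inj₁ (_ , j∈C₁) = inj₁ j∈C₁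
  ... | inj₂ (inj₁ ((a≤i , _) , _)) = contradiction i<a (≤⇒≯ a≤i)
  ... | inj₂ (inj₂ (i∈R₁ , j∈C₂)) = inj₂ (adjacent i _ i∈R₁ j∈C₂ (colOf-one Q pm i))
  a≤c+2 : a ≤ c + 2
  a≤c+2 = interval-size-≤ {lo = 0} (<⇒≤ a<k)
    (AtMost-⊎ (AtMost-preimage (colOf Q pm) (colOf-injective Q pm) (AtMost-In {lo = 0} {hi = c})) (AtMost-adjacent r)) R₁-fate
  event : Event Q (descriptor₁ c)
  event = mapsInto λ o j∈ →
    In⇒interval (z≤n , <-≤-trans (C₁-rows o (proj₂ (interval⇒In {lo = 0} {hi = c} j∈))) (⊓-glb a≤c+2 (<⇒≤pred a<k)))

record Class2Shape {k} (X : Matrix k) (a b c : ℕ) : Set where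
  field
    C₁-rows : ∀ {i j} → One X i j → toℕ j < c → In a b i
    b≤cap : b ≤ cappedBelow {k} (a + c + 2)
    a∈ : a ∈ between 1 (pred k)
    c∈ : c ∈ between 2 k

Class2At-shape : ∀ {k} {X : Matrix k} {a b c} → IsPermMatrix X → Class2At X a b c → Class2Shape X a b c
Class2At-shape {k} {X} {a} {b} {c} pm
  (0<a , a<b , b<k , _ , c<k , _ , _ , (_ , _ , _ , _ , _ , j∈C₁ , o , _ , j'∈C₁ , o' , i≢i') , blocks , r , adjacent) =
  record
    { C₁-rows = C₁-rows ; b≤cap = ⊓-glb b≤a+c+2 (<⇒≤pred b<k)
    ; a∈ = ∈-between 0<a (<⇒≤pred (≤-<-trans a<b b<k)) ; c∈ = ∈-between 2≤c c<k }
  where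
  C₁-rows : ∀ {i j} → One X i j → toℕ j < c → In a b i
  C₁-rows o j<c with blocks _ _ o
  ... | inj₁ (_ , c≤j , _) = contradiction j<c (≤⇒≯ c≤j)
  ... | inj₂ (inj₁ (_ , c≤j , _)) = contradiction j<c (≤⇒≯ c≤j)
  ... | inj₂ (inj₂ (inj₁ (i∈R₂ , _))) = i∈R₂
  ... | inj₂ (inj₂ (inj₂ (_ , c≤j , _))) = contradiction j<c (≤⇒≯ c≤j)
  R₂-fate : ∀ {i} → In a b i → In 0 c (colOf X pm i) ⊎ (toℕ i ≡ r ⊎ toℕ i ≡ suc r)
  R₂-fate {i} (a≤i , i<b) with blocks i _ (colOf-one X pm i)
  ... | inj₁ ((_ , i<a) , _) = contradiction i<a (≤⇒≯ a≤i)
  ... | inj₂ (inj₁ ((b≤i , _) , _)) = contradiction i<b (≤⇒≯ b≤i)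
  ... | inj₂ (inj₂ (inj₁ (_ , j∈C₁))) = inj₁ j∈C₁
  ... | inj₂ (inj₂ (inj₂ (i∈R₂ , j∈C₂))) = inj₂ (adjacent i _ i∈R₂ j∈C₂ (colOf-one X pm i))
  b≤a+c+2 : b ≤ a + c + 2
  b≤a+c+2 = begin
    b                 ≡⟨ m+[n∸m]≡n (<⇒≤ a<b) ⟨
    a + (b ∸ a)       ≤⟨ +-monoʳ-≤ a (interval-size-≤ (<⇒≤ b<k)
                           (AtMost-⊎ (AtMost-preimage (colOf X pm) (colOf-injective X pm) (AtMost-In {lo = 0} {hi = c})) (AtMost-adjacent r)) R₂-fate) ⟩
    a + (c + 2)       ≡⟨ +-assoc a c 2 ⟨
    a + c + 2         ∎
    where open ≤-Reasoning
  2≤c : 2 ≤ c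
  2≤c = AtMost-two (AtMost-In {lo = 0} {hi = c}) (ones-in-distinct-rows X pm o o' i≢i') j∈C₁ j'∈C₁

Class2⇒family₂ : ∀ {k} {Q : Matrix k} → IsPermMatrix Q → Class2 Q → Any (Event Q) (family₂ {k})
Class2⇒family₂ {Q = Q} pm (a , b , c , cl) = lose-concatMap-map a∈ c∈ (mapsInto λ o j∈ →
  let (a≤i , i<b) = C₁-rows o (proj₂ (interval⇒In {lo = 0} j∈)) in In⇒interval (a≤i , <-≤-trans i<b b≤cap))
  where open Class2Shape (Class2At-shape {X = Q} pm cl)

module _ {n} (X : Matrix (suc n)) (r : Fin (suc n)) where

  sourceRow : Fin (suc n) → Fin (suc n)
  sourceRow zero = r
  sourceRow (suc i) = punchIn r i

  targetRow : Fin (suc n) → Fin (suc n)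
  targetRow x with r Fin.≟ x
  ... | yes _ = zero
  ... | no r≢x = suc (punchOut r≢x)

  sourceRow-targetRow : ∀ x → sourceRow (targetRow x) ≡ x
  sourceRow-targetRow x with r Fin.≟ x
  ... | yes r≡x = r≡x
  ... | no r≢x = punchIn-punchOut r≢x

  entry-moveRowToTop : ∀ p j → entry (moveRowToTop X r) p j ≡ entry X (sourceRow p) j
  entry-moveRowToTop zero j = refl
  entry-moveRowToTop (suc i) j = cong (λ row → lookup row j) (lookup-removeAt X r i)

  IsPermMatrix-moveRowToTop⁻ : IsPermMatrix (moveRowToTop X r) → IsPermMatrix X
  IsPermMatrix-moveRowToTop⁻ (rows , cols) = rows' , cols'
    where
    P = moveRowToTop X r
    to-X : ∀ {p j} → One P p j → One X (sourceRow p) j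
    to-X {p} {j} o = trans (sym (entry-moveRowToTop p j)) o
    to-P : ∀ {x j} → One X x j → One P (targetRow x) j
    to-P {x} {j} o = trans (entry-moveRowToTop (targetRow x) j) (trans (cong (λ y → entry X y j) (sourceRow-targetRow x)) o)
    rows' : ∀ x → ∃ λ j → One X x j × (∀ j' → One X x j' → j' ≡ j)
    rows' x with rows (targetRow x)
    ... | j , o , uq = j , subst (λ y → One X y j) (sourceRow-targetRow x) (to-X {targetRow x} o) , λ j' o' → uq j' (to-P o')
    cols' : ∀ j → ∃ λ x → One X x j × (∀ x' → One X x' j → x' ≡ x)
    cols' j with cols j
    ... | p , o , uq = sourceRow p , to-X {p} o , λ x' o' → trans (sym (sourceRow-targetRow x')) (cong sourceRow (uq (targetRow x') (to-P o')))

Class3⇒family₃ : ∀ {k} {P : Matrix k} → IsPermMatrix P → Class3 P → Any (Event P) (family₃ {k})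
Class3⇒family₃ {zero} _ (_ , _ , _ , _ , _ , () , _)
Class3⇒family₃ {suc n} pmP (X , a , b , c , cl , r , _ , (a≤r , r<b) , _ , _ , _ , refl) =
  lose-concatMap-map a∈ c∈ (mapsInto λ {p} {j} → C₁-rows-after-move {p} {j})
  where
  open Class2Shape (Class2At-shape {X = X} (IsPermMatrix-moveRowToTop⁻ X r pmP) cl)
  C₁-rows-after-move : ∀ {p j} → One (moveRowToTop X r) p j → interval 0 c j ≡ true →
    (interval 0 1 p ∨ interval (suc a) (cappedBelow {suc n} (a + c + 2)) p) ≡ true
  C₁-rows-after-move {zero} {j} _ _ = refl
  C₁-rows-after-move {suc i} {j} o j∈
    with C₁-rows (trans (sym (entry-moveRowToTop X r (suc i) j)) o) (proj₂ (interval⇒In {lo = 0} j∈)) | toℕ-punchIn r i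
  ... | a≤i , _ | inj₁ (i<r , e) =
    ∨-≡-true {interval 0 1 (suc i)} (inj₂ (In⇒interval (s≤s (subst (a ≤_) e a≤i) , <-≤-trans (≤-<-trans i<r r<b) b≤cap)))
  ... | _ , i+1<b | inj₂ (r≤i , e) =
    ∨-≡-true {interval 0 1 (suc i)} (inj₂ (In⇒interval (s≤s (≤-trans a≤r r≤i) , <-≤-trans (subst (_< b) e i+1<b) b≤cap)))

Class4⇒family₄ : ∀ {k} {Q : Matrix k} → IsPermMatrix Q → Class4 Q → Any (Event Q) (family₄ {k})
Class4⇒family₄ {k} {Q} pm (a , b , c , d , 0<a , a<b , b<k , 0<c , c<d , d<k ,
    (i₁ , _ , (_ , i₁<a) , j₁∈C₂ , o₁) , _ , _ , (i₃ , _ , (b≤i₃ , _) , j₃∈C₂ , o₃) , blocks) =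
  Any.concatMap⁺ _ (lose s∈ (lose-concatMap-map a∈ c∈ event))
  where
  s = c + (k ∸ d)
  0<k∸d : 0 < k ∸ d
  0<k∸d = m<n⇒0<n∸m d<k
  s+[d∸c]≡k : s + (d ∸ c) ≡ k
  s+[d∸c]≡k = begin
    c + (k ∸ d) + (d ∸ c)   ≡⟨ +-assoc c (k ∸ d) (d ∸ c) ⟩
    c + ((k ∸ d) + (d ∸ c)) ≡⟨ cong (c +_) (+-comm (k ∸ d) (d ∸ c)) ⟩
    c + ((d ∸ c) + (k ∸ d)) ≡⟨ +-assoc c (d ∸ c) (k ∸ d) ⟨
    c + (d ∸ c) + (k ∸ d)   ≡⟨ cong (_+ (k ∸ d)) (m+[n∸m]≡n (<⇒≤ c<d)) ⟩
    d + (k ∸ d)             ≡⟨ m+[n∸m]≡n (<⇒≤ d<k) ⟩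
    k                       ∎
    where open ≡-Reasoning
  s≤k : s ≤ k
  s≤k = subst (s ≤_) s+[d∸c]≡k (m≤m+n s (d ∸ c))
  c+[k∸s]≡d : c + (k ∸ s) ≡ d
  c+[k∸s]≡d = trans (cong (λ n → c + (n ∸ s)) (sym s+[d∸c]≡k)) (trans (cong (c +_) (m+n∸m≡n s (d ∸ c))) (m+[n∸m]≡n (<⇒≤ c<d)))
  outer : ∀ {j} → outerColumns s c j ≡ true → toℕ j < c ⊎ d ≤ toℕ j
  outer {j} e with ∨-≡-true⁻ e
  ... | inj₁ j∈C₁ = inj₁ (proj₂ (interval⇒In {lo = 0} {hi = c} j∈C₁))
  ... | inj₂ j∈C₃ = inj₂ (subst (_≤ toℕ j) c+[k∸s]≡d (proj₁ (interval⇒In {lo = c + (k ∸ s)} {hi = k} j∈C₃)))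
  outer-rows : ∀ {i j} → One Q i j → toℕ j < c ⊎ d ≤ toℕ j → In a b i
  outer-rows o j-outer with blocks _ _ o | j-outer
  ... | inj₁ (_ , c≤j , _) | inj₁ j<c = contradiction j<c (≤⇒≯ c≤j)
  ... | inj₁ (_ , _ , j<d) | inj₂ d≤j = contradiction j<d (≤⇒≯ d≤j)
  ... | inj₂ (inj₁ (i∈R₂ , _)) | _ = i∈R₂
  ... | inj₂ (inj₂ (inj₁ (i∈R₂ , _))) | _ = i∈R₂
  ... | inj₂ (inj₂ (inj₂ (_ , c≤j , _))) | inj₁ j<c = contradiction j<c (≤⇒≯ c≤j)
  ... | inj₂ (inj₂ (inj₂ (_ , _ , j<d))) | inj₂ d≤j = contradiction j<d (≤⇒≯ d≤j)
  R₂-fate : ∀ {i} → In a b i → In 0 c (colOf Q pm i) ⊎ In d k (colOf Q pm i)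
  R₂-fate {i} (a≤i , i<b) with blocks i _ (colOf-one Q pm i)
  ... | inj₁ ((_ , i<a) , _) = contradiction i<a (≤⇒≯ a≤i)
  ... | inj₂ (inj₁ (_ , j∈C₁)) = inj₁ j∈C₁
  ... | inj₂ (inj₂ (inj₁ (_ , j∈C₃))) = inj₂ j∈C₃
  ... | inj₂ (inj₂ (inj₂ ((b≤i , _) , _))) = contradiction i<b (≤⇒≯ b≤i)
  b∸a≤s : b ∸ a ≤ s
  b∸a≤s = interval-size-≤ (<⇒≤ b<k)
    (AtMost-preimage (colOf Q pm) (colOf-injective Q pm) (AtMost-⊎ (AtMost-In {lo = 0} {hi = c}) (AtMost-In {lo = d} {hi = k}))) R₂-fate
  s≤b∸a : s ≤ b ∸ a
  s≤b∸a = subst (_≤ b ∸ a) (m∸[m∸n]≡n s≤k)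
    (large-subset-≤ (Descriptor.colSet-coAtMost (descriptor₄ {k} s a c))
      (AtMost-preimage (rowOf Q pm) (rowOf-injective Q pm) (AtMost-In {lo = a} {hi = b}))
      (λ j∈ → outer-rows (rowOf-one Q pm _) (outer j∈)))
  b≡a+s : b ≡ a + s
  b≡a+s = trans (sym (m+[n∸m]≡n (<⇒≤ a<b))) (cong (a +_) (≤-antisym b∸a≤s s≤b∸a))
  i₁≢i₃ : i₁ ≢ i₃
  i₁≢i₃ refl = contradiction (<-trans i₁<a a<b) (≤⇒≯ b≤i₃)
  2≤d∸c : 2 ≤ d ∸ c
  2≤d∸c = AtMost-two (AtMost-In {lo = c} {hi = d}) (ones-in-distinct-rows Q pm o₁ o₃ i₁≢i₃) j₁∈C₂ j₃∈C₂
  s∈ : s ∈ between 2 (pred k)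
  s∈ = ∈-between (+-mono-≤ 0<c 0<k∸d) (<⇒≤pred (subst (_≤ k) (+-comm s 2) (subst (s + 2 ≤_) s+[d∸c]≡k (+-monoʳ-≤ s 2≤d∸c))))
  a∈ : a ∈ between 1 (k ∸ s)
  a∈ = ∈-between 0<a (m+n≤o⇒m≤o∸n (suc a) (subst (_< k) b≡a+s b<k))
  c∈ : c ∈ between 1 s
  c∈ = ∈-between 0<c (m<m+n c 0<k∸d)
  event : Event Q (descriptor₄ s a c)
  event = mapsInto λ o j∈ → let (a≤i , i<b) = outer-rows o (outer j∈) in In⇒interval (a≤i , subst (_ <_) b≡a+s i<b)

family : ∀ {k} → List (Descriptor k)
family = family₁ ++ family₂ ++ family₃ ++ family₄

NonOrdinary⇒InOrbit : ∀ {k} {Q : Matrix k} → IsPermMatrix Q → NonOrdinary Q → InOrbit family Q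
NonOrdinary⇒InOrbit pm (inj₁ r) =
  ReducesTo-InOrbit family (λ pm' c → Any.++⁺ˡ (Class1⇒family₁ pm' c)) pm r
NonOrdinary⇒InOrbit pm (inj₂ (inj₁ r)) =
  ReducesTo-InOrbit family (λ pm' c → Any.++⁺ʳ family₁ (Any.++⁺ˡ (Class2⇒family₂ pm' c))) pm r
NonOrdinary⇒InOrbit pm (inj₂ (inj₂ (inj₁ r))) =
  ReducesTo-InOrbit family (λ pm' c → Any.++⁺ʳ family₁ (Any.++⁺ʳ family₂ (Any.++⁺ˡ (Class3⇒family₃ pm' c)))) pm r
NonOrdinary⇒InOrbit pm (inj₂ (inj₂ (inj₂ r))) =
  ReducesTo-InOrbit family (λ pm' c → Any.++⁺ʳ family₁ (Any.++⁺ʳ family₂ (Any.++⁺ʳ family₃ (Class4⇒family₄ pm' c)))) pm r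

AtMost-NonOrdinary : ∀ k → AtMost (8 * sum (map weight (family {k}))) (λ Q → IsPermMatrix Q × NonOrdinary Q)
AtMost-NonOrdinary k = AtMost-⊆ (λ (pm , non) → NonOrdinary⇒InOrbit pm non) (AtMost-InOrbit (family {k}))

-- The total weight

weight-≤ : ∀ {k} a N (d : Descriptor k) → let open Descriptor d in
  u + v ≤ N → u ≤ N ∸ a → v ≤ N ∸ a → weight d ≤ a ! * (N ∸ a) !
weight-≤ a N d = factorial-product-≤ a N (Descriptor.u d) (Descriptor.v d)

m≤o+2⇒m+[n∸o]≤2+n : ∀ {u c k} → u ≤ c + 2 → c ≤ k → u + (k ∸ c) ≤ 2 + k
m≤o+2⇒m+[n∸o]≤2+n {u} {c} {k} u≤c+2 c≤k = begin
  u + (k ∸ c)        ≤⟨ +-monoˡ-≤ (k ∸ c) u≤c+2 ⟩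
  c + 2 + (k ∸ c)    ≡⟨ cong (_+ (k ∸ c)) (+-comm c 2) ⟩
  2 + c + (k ∸ c)    ≡⟨ +-assoc 2 c (k ∸ c) ⟩
  2 + (c + (k ∸ c))  ≡⟨ cong (2 +_) (m+[n∸m]≡n c≤k) ⟩
  2 + k              ∎
  where open ≤-Reasoning

m<1+n⇒m+2≤2+n : ∀ {x m} → x < suc m → x + 2 ≤ 2 + m
m<1+n⇒m+2≤2+n {x} {m} (s≤s x≤m) = subst (_≤ 2 + m) (+-comm 2 x) (s≤s (s≤s x≤m))

module _ (n : ℕ) where

  private
    k = 7 + n
    D₁ : ℕ → Descriptor k
    D₁ = descriptor₁

  absorb : ∀ x c → x ≤ 6 + n → x * (c * (5 + n) !) ≤ c * (6 + n) !
  absorb x c x≤ = ≤-trans (*-monoˡ-≤ (c * (5 + n) !) x≤) (≤-reflexive (x∙yz≈y∙xz (6 + n) c ((5 + n) !)))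

  absorb₂ : ∀ x y c → x ≤ 5 + n → y ≤ 6 + n → y * (x * (c * (4 + n) !)) ≤ c * (6 + n) !
  absorb₂ x y c x≤ y≤ =
    ≤-trans (*-monoʳ-≤ y (≤-trans (*-monoˡ-≤ (c * (4 + n) !) x≤) (≤-reflexive (x∙yz≈y∙xz (5 + n) c ((4 + n) !))))) (absorb y c y≤)

  family₁-weight : sum (map weight (family₁ {k})) ≤ 48 * (6 + n) !
  family₁-weight = begin
    sum (map weight (family₁ {k}))                            ≡⟨ sum-map-map weight D₁ (range 1 (6 + n)) ⟩
    sum (map (weight ∘ D₁) (range 1 (6 + n)))       ≡⟨ cong (λ m → sum (map (weight ∘ D₁) (range 1 (3 + m)))) (+-comm 3 n) ⟩
    sum (map (weight ∘ D₁) (range 1 (1 + ((2 + n) + 3))))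
      ≤⟨ sum-range-split₃ (weight ∘ D₁) 1 1 (2 + n) 3
           (λ c 1≤c c<2 → outer c 1≤c (<-≤-trans c<2 (s≤s (s≤s z≤n))))
           inner
           (λ c 4+n≤c c<7+n → outer c (≤-trans (s≤s z≤n) 4+n≤c) (subst (c <_) (cong (4 +_) (+-comm n 3)) c<7+n)) ⟩
    1 * (6 * (6 + n) !) + ((2 + n) * (24 * (5 + n) !) + 3 * (6 * (6 + n) !))
      ≤⟨ +-mono-≤ (≤-reflexive (*-identityˡ (6 * (6 + n) !)))
           (+-mono-≤ (absorb (2 + n) 24 (+-monoˡ-≤ n (s≤s (s≤s z≤n)))) (≤-reflexive (sym (*-assoc 3 6 ((6 + n) !))))) ⟩
    6 * (6 + n) ! + (24 * (6 + n) ! + 18 * (6 + n) !)        ≡⟨ sum-of-multiples 6 24 18 ((6 + n) !) ⟩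
    48 * (6 + n) !                                            ∎
    where
    open ≤-Reasoning
    u≤c+2 : ∀ c → Descriptor.u (D₁ c) ≤ c + 2
    u≤c+2 c = m⊓n≤m (c + 2) (6 + n)
    outer : ∀ c → 1 ≤ c → c < 7 + n → weight (D₁ c) ≤ 6 * (6 + n) !
    outer c 1≤c c<k =
      weight-≤ 3 (9 + n) (D₁ c) (m≤o+2⇒m+[n∸o]≤2+n (u≤c+2 c) (<⇒≤ c<k)) (m⊓n≤n (c + 2) (6 + n)) (∸-monoʳ-≤ k 1≤c)
    inner : ∀ c → 2 ≤ c → c < 4 + n → weight (D₁ c) ≤ 24 * (5 + n) !
    inner c 2≤c c<4+n = weight-≤ 4 (9 + n) (D₁ c) (m≤o+2⇒m+[n∸o]≤2+n (u≤c+2 c) (<⇒≤ (<-≤-trans c<4+n (m≤n+m (4 + n) 3))))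
      (≤-trans (u≤c+2 c) (m<1+n⇒m+2≤2+n c<4+n)) (∸-monoʳ-≤ k 2≤c)

  band-row-weight : (D : ℕ → Descriptor k) → (∀ c → Descriptor.u (D c) ≤ c + 2) → (∀ c → Descriptor.u (D c) ≤ 5 + n) →
    (∀ c → Descriptor.v (D c) ≡ k ∸ c) →
    sum (map (weight ∘ D) (range 2 (5 + n))) ≤ 1 * (24 * (5 + n) !) + (n * (120 * (4 + n) !) + 4 * (24 * (5 + n) !))
  band-row-weight D u≤c+2 u≤5+n v≡ = begin
    sum (map (weight ∘ D) (range 2 (5 + n)))              ≡⟨ cong (λ m → sum (map (weight ∘ D) (range 2 (1 + m)))) (+-comm 4 n) ⟩
    sum (map (weight ∘ D) (range 2 (1 + (n + 4))))
      ≤⟨ sum-range-split₃ (weight ∘ D) 2 1 n 4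
           (λ c 2≤c c<3 → outer c 2≤c (<-≤-trans c<3 (s≤s (s≤s (s≤s z≤n)))))
           inner
           (λ c 3+n≤c c<7+n → outer c (≤-trans (s≤s (s≤s z≤n)) 3+n≤c) (subst (c <_) (cong (3 +_) (+-comm n 4)) c<7+n)) ⟩
    1 * (24 * (5 + n) !) + (n * (120 * (4 + n) !) + 4 * (24 * (5 + n) !))  ∎
    where
    open ≤-Reasoning
    u+v≤ : ∀ c → c ≤ k → Descriptor.u (D c) + Descriptor.v (D c) ≤ 9 + n
    u+v≤ c c≤k = subst (λ v → Descriptor.u (D c) + v ≤ 9 + n) (sym (v≡ c)) (m≤o+2⇒m+[n∸o]≤2+n (u≤c+2 c) c≤k)
    outer : ∀ c → 2 ≤ c → c < 7 + n → weight (D c) ≤ 24 * (5 + n) !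
    outer c 2≤c c<k = weight-≤ 4 (9 + n) (D c) (u+v≤ c (<⇒≤ c<k)) (u≤5+n c)
      (subst (_≤ 5 + n) (sym (v≡ c)) (∸-monoʳ-≤ k 2≤c))
    inner : ∀ c → 3 ≤ c → c < 3 + n → weight (D c) ≤ 120 * (4 + n) !
    inner c 3≤c c<3+n = weight-≤ 5 (9 + n) (D c) (u+v≤ c (<⇒≤ (<-≤-trans c<3+n (m≤n+m (3 + n) 4))))
      (≤-trans (u≤c+2 c) (m<1+n⇒m+2≤2+n c<3+n)) (subst (_≤ 4 + n) (sym (v≡ c)) (∸-monoʳ-≤ k 3≤c))

  band-weight : (D : ℕ → ℕ → Descriptor k) → (∀ a c → Descriptor.u (D a c) ≤ c + 2) →
    (∀ a c → 1 ≤ a → Descriptor.u (D a c) ≤ 5 + n) → (∀ a c → Descriptor.v (D a c) ≡ k ∸ c) →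
    sum (map weight (concatMap (λ a → map (D a) (range 2 (5 + n))) (range 1 (5 + n)))) ≤ 240 * (6 + n) !
  band-weight D u≤c+2 u≤5+n v≡ = begin
    sum (map weight (concatMap (λ a → map (D a) (range 2 (5 + n))) (range 1 (5 + n))))
      ≡⟨ sum-map-concatMap weight (λ a → map (D a) (range 2 (5 + n))) (range 1 (5 + n)) ⟩
    sum (map (λ a → sum (map weight (map (D a) (range 2 (5 + n))))) (range 1 (5 + n)))
      ≤⟨ sum-range-≤ _ 1 (5 + n) (λ a 1≤a _ → ≤-trans (≤-reflexive (sum-map-map weight (D a) (range 2 (5 + n))))
           (band-row-weight (D a) (u≤c+2 a) (λ c → u≤5+n a c 1≤a) (v≡ a))) ⟩
    (5 + n) * (1 * (24 * (5 + n) !) + (n * (120 * (4 + n) !) + 4 * (24 * (5 + n) !)))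
      ≡⟨ *-distribˡ-+ (5 + n) (1 * (24 * (5 + n) !)) _ ⟩
    (5 + n) * (1 * (24 * (5 + n) !)) + (5 + n) * (n * (120 * (4 + n) !) + 4 * (24 * (5 + n) !))
      ≡⟨ cong ((5 + n) * (1 * (24 * (5 + n) !)) +_) (*-distribˡ-+ (5 + n) (n * (120 * (4 + n) !)) _) ⟩
    (5 + n) * (1 * (24 * (5 + n) !)) + ((5 + n) * (n * (120 * (4 + n) !)) + (5 + n) * (4 * (24 * (5 + n) !)))
      ≤⟨ +-mono-≤ (≤-trans (≤-reflexive (cong ((5 + n) *_) (*-identityˡ (24 * (5 + n) !)))) (absorb (5 + n) 24 (n≤1+n (5 + n))))
           (+-mono-≤ (absorb₂ n (5 + n) 120 (m≤n+m n 5) (n≤1+n (5 + n)))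
                     (≤-trans (≤-reflexive (cong ((5 + n) *_) (sym (*-assoc 4 24 ((5 + n) !))))) (absorb (5 + n) 96 (n≤1+n (5 + n))))) ⟩
    24 * (6 + n) ! + (120 * (6 + n) ! + 96 * (6 + n) !)  ≡⟨ sum-of-multiples 24 120 96 ((6 + n) !) ⟩
    240 * (6 + n) !  ∎
    where open ≤-Reasoning

  family₂-weight : sum (map weight (family₂ {k})) ≤ 240 * (6 + n) !
  family₂-weight = band-weight descriptor₂ u≤c+2 u≤5+n (λ _ _ → refl)
    where
    u≤c+2 : ∀ a c → Descriptor.u (descriptor₂ {k} a c) ≤ c + 2
    u≤c+2 a c = ≤-trans (∸-monoˡ-≤ a (m⊓n≤m (a + c + 2) (6 + n)))
      (≤-reflexive (trans (cong (_∸ a) (+-assoc a c 2)) (m+n∸m≡n a (c + 2))))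
    u≤5+n : ∀ a c → 1 ≤ a → Descriptor.u (descriptor₂ {k} a c) ≤ 5 + n
    u≤5+n a c 1≤a = ≤-trans (∸-monoˡ-≤ a (m⊓n≤n (a + c + 2) (6 + n))) (∸-monoʳ-≤ (6 + n) 1≤a)

  family₃-weight : sum (map weight (family₃ {k})) ≤ 240 * (6 + n) !
  family₃-weight = band-weight descriptor₃ u≤c+2 u≤5+n (λ _ _ → refl)
    where
    u≤c+2 : ∀ a c → Descriptor.u (descriptor₃ {k} a c) ≤ c + 2
    u≤c+2 a c = subst (Descriptor.u (descriptor₃ {k} a c) ≤_) (sym (+-suc c 1)) (s≤s (≤-trans (∸-monoˡ-≤ (suc a) (m⊓n≤m (a + c + 2) (6 + n)))
      (≤-reflexive (trans (cong (_∸ suc a) a+c+2≡) (m+n∸m≡n (suc a) (c + 1))))))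
      where
      a+c+2≡ : a + c + 2 ≡ suc a + (c + 1)
      a+c+2≡ = trans (+-assoc a c 2) (trans (cong (a +_) (+-suc c 1)) (+-suc a (c + 1)))
    u≤5+n : ∀ a c → 1 ≤ a → Descriptor.u (descriptor₃ {k} a c) ≤ 5 + n
    u≤5+n a c 1≤a = s≤s (≤-trans (∸-monoˡ-≤ (suc a) (m⊓n≤n (a + c + 2) (6 + n))) (∸-monoʳ-≤ (6 + n) (s≤s 1≤a)))

  slab : ℕ → List (Descriptor k)
  slab s = concatMap (λ a → map (descriptor₄ s a) (range 1 (s ∸ 1))) (range 1 (k ∸ s ∸ 1))

  slab-weight : ∀ s → sum (map weight (slab s)) ≤ suc s ! * suc (k ∸ s) !
  slab-weight s = begin
    sum (map weight (slab s))
      ≡⟨ sum-map-concatMap weight (λ a → map (descriptor₄ s a) (range 1 (s ∸ 1))) (range 1 (k ∸ s ∸ 1)) ⟩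
    sum (map (λ a → sum (map weight (map (descriptor₄ s a) (range 1 (s ∸ 1))))) (range 1 (k ∸ s ∸ 1)))
      ≤⟨ sum-range-≤ _ 1 (k ∸ s ∸ 1) (λ a _ _ → ≤-trans (≤-reflexive (sum-map-map weight (descriptor₄ s a) (range 1 (s ∸ 1))))
           (sum-range-≤ (weight ∘ descriptor₄ {k} s a) 1 (s ∸ 1) λ _ _ _ → ≤-refl)) ⟩
    (k ∸ s ∸ 1) * ((s ∸ 1) * (s ! * (k ∸ s) !))      ≡⟨ cong ((k ∸ s ∸ 1) *_) (*-assoc (s ∸ 1) (s !) ((k ∸ s) !)) ⟨
    (k ∸ s ∸ 1) * ((s ∸ 1) * s ! * (k ∸ s) !)        ≡⟨ x∙yz≈y∙xz (k ∸ s ∸ 1) ((s ∸ 1) * s !) ((k ∸ s) !) ⟩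
    (s ∸ 1) * s ! * ((k ∸ s ∸ 1) * (k ∸ s) !)
      ≤⟨ *-mono-≤ (*-monoˡ-≤ (s !) (≤-trans (m∸n≤m s 1) (n≤1+n s))) (*-monoˡ-≤ ((k ∸ s) !) (≤-trans (m∸n≤m (k ∸ s) 1) (n≤1+n (k ∸ s)))) ⟩
    suc s ! * suc (k ∸ s) !                           ∎
    where open ≤-Reasoning

  family₄-weight : sum (map weight (family₄ {k})) ≤ 36 * (6 + n) !
  family₄-weight = begin
    sum (map weight (family₄ {k}))          ≡⟨ sum-map-concatMap weight slab (range 2 (4 + n)) ⟩
    sum (map (sum ∘ map weight ∘ slab) (range 2 (4 + n)))
                                            ≡⟨ cong (λ m → sum (map (sum ∘ map weight ∘ slab) (range 2 (3 + m)))) (+-comm 1 n) ⟩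
    sum (map (sum ∘ map weight ∘ slab) (range 2 (1 + ((2 + n) + 1))))
      ≤⟨ sum-range-split₃ (sum ∘ map weight ∘ slab) 2 1 (2 + n) 1
           (λ s 2≤s s<3 → outer s 2≤s (<-≤-trans s<3 (s≤s (s≤s (s≤s z≤n)))))
           inner
           (λ s 5+n≤s s<6+n → outer s (≤-trans (s≤s (s≤s z≤n)) 5+n≤s) (subst (s <_) (cong (5 +_) (+-comm n 1)) s<6+n)) ⟩
    1 * (6 * (6 + n) !) + ((2 + n) * (24 * (5 + n) !) + 1 * (6 * (6 + n) !))
      ≤⟨ +-mono-≤ (≤-reflexive (*-identityˡ (6 * (6 + n) !)))
           (+-mono-≤ (absorb (2 + n) 24 (+-monoˡ-≤ n (s≤s (s≤s z≤n)))) (≤-reflexive (*-identityˡ (6 * (6 + n) !)))) ⟩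
    6 * (6 + n) ! + (24 * (6 + n) ! + 6 * (6 + n) !)  ≡⟨ sum-of-multiples 6 24 6 ((6 + n) !) ⟩
    36 * (6 + n) !                                    ∎
    where
    open ≤-Reasoning
    slab-size : ∀ s → s ≤ k → suc s + suc (k ∸ s) ≤ 9 + n
    slab-size s s≤k = ≤-reflexive (trans (cong suc (+-suc s (k ∸ s))) (cong (λ m → suc (suc m)) (m+[n∸m]≡n s≤k)))
    outer : ∀ s → 2 ≤ s → s < 6 + n → sum (map weight (slab s)) ≤ 6 * (6 + n) !
    outer s 2≤s s<6+n = ≤-trans (slab-weight s)
      (factorial-product-≤ 3 (9 + n) (suc s) (suc (k ∸ s)) (slab-size s s≤k) s<6+n (s≤s (∸-monoʳ-≤ k 2≤s)))
      where s≤k = ≤-trans (<⇒≤ s<6+n) (n≤1+n (6 + n))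
    inner : ∀ s → 3 ≤ s → s < 5 + n → sum (map weight (slab s)) ≤ 24 * (5 + n) !
    inner s 3≤s s<5+n = ≤-trans (slab-weight s)
      (factorial-product-≤ 4 (9 + n) (suc s) (suc (k ∸ s)) (slab-size s s≤k) s<5+n (s≤s (∸-monoʳ-≤ k 3≤s)))
      where s≤k = ≤-trans (<⇒≤ s<5+n) (≤-trans (n≤1+n (5 + n)) (n≤1+n (6 + n)))

  family-weight : sum (map weight (family {k})) ≤ 564 * (6 + n) !
  family-weight = begin
    sum (map weight (family {k}))
      ≡⟨ sum-map-++ weight (family₁ {k}) (family₂ ++ family₃ ++ family₄) ⟩
    sum (map weight (family₁ {k})) + sum (map weight (family₂ {k} ++ family₃ ++ family₄))
      ≡⟨ cong (sum (map weight (family₁ {k})) +_) (sum-map-++ weight (family₂ {k}) (family₃ ++ family₄)) ⟩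
    sum (map weight (family₁ {k})) + (sum (map weight (family₂ {k})) + sum (map weight (family₃ {k} ++ family₄)))
      ≡⟨ cong (λ x → sum (map weight (family₁ {k})) + (sum (map weight (family₂ {k})) + x)) (sum-map-++ weight (family₃ {k}) family₄) ⟩
    sum (map weight (family₁ {k})) + (sum (map weight (family₂ {k})) + (sum (map weight (family₃ {k})) + sum (map weight (family₄ {k}))))
      ≤⟨ +-mono-≤ family₁-weight (+-mono-≤ family₂-weight (+-mono-≤ family₃-weight family₄-weight)) ⟩
    48 * (6 + n) ! + (240 * (6 + n) ! + (240 * (6 + n) ! + 36 * (6 + n) !))
      ≡⟨ cong (48 * (6 + n) ! +_) (sum-of-multiples 240 240 36 ((6 + n) !)) ⟩
    48 * (6 + n) ! + 516 * (6 + n) !  ≡⟨ *-distribʳ-+ ((6 + n) !) 48 516 ⟨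
    564 * (6 + n) !  ∎
    where open ≤-Reasoning

AtMost-NonOrdinary-≤ : ∀ n → AtMost (4512 * (6 + n) !) (λ (Q : Matrix (7 + n)) → IsPermMatrix Q × NonOrdinary Q)
AtMost-NonOrdinary-≤ n Qs u ps = begin
  length Qs                              ≤⟨ AtMost-NonOrdinary (7 + n) Qs u ps ⟩
  8 * sum (map weight (family {7 + n}))  ≤⟨ *-monoʳ-≤ 8 (family-weight n) ⟩
  8 * (564 * (6 + n) !)                  ≡⟨ *-assoc 8 564 ((6 + n) !) ⟨
  4512 * (6 + n) !                       ∎
  where open ≤-Reasoning

lemma3 : ∀ (m : ℕ) → ∃ λ (K : ℕ) → ∀ (k : ℕ) → K ≤ k →
    ∀ (L : List (Matrix k)) → Unique L →
    All (λ Q → IsPermMatrix Q × NonOrdinary Q) L →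
    m * length L ≤ k !
lemma3 m = 7 + m * 4512 , bound
  where
  bound : ∀ k → 7 + m * 4512 ≤ k → ∀ (L : List (Matrix k)) → Unique L → All (λ Q → IsPermMatrix Q × NonOrdinary Q) L → m * length L ≤ k !
  bound k K≤k L u ps with m≤n⇒∃[o]m+o≡n K≤k
  ... | o , refl = begin
    m * length L               ≤⟨ *-monoʳ-≤ m (AtMost-NonOrdinary-≤ r L u ps) ⟩
    m * (4512 * (6 + r) !)     ≡⟨ *-assoc m 4512 ((6 + r) !) ⟨
    m * 4512 * (6 + r) !       ≤⟨ *-monoˡ-≤ ((6 + r) !) (≤-trans (m≤m+n (m * 4512) o) (m≤n+m r 7)) ⟩
    (7 + r) !                  ∎
    where
    open ≤-Reasoning
    r = m * 4512 + o
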